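{- Let $\omega$ be a permutation with tower diagram $\mathcal T$ and Rothe diagram $D=D_\omega$. Then sending a corner cell of $\mathcal T$ lying in the tower with index $c$ to the border cell of $D$ lying in column $c$ gives a well-defined bijection between the set $C_{\mathcal T}$ of corner cells of $\mathcal T$ and the set $B_D$ of border cells of $D$ (i.e. the correspondence is given by reading column indices).
   Context: Permutations are written in one-line notation $\omega=\omega_1\cdots\omega_n$; $s_a=(a,a+1)$ and $\omega s_a$ swaps the entries in positions $a,a+1$; a reduced word of $\omega$ is a word $\alpha_1\cdots\alpha_l$ with $\omega=s_{\alpha_1}\cdots s_{\alpha_l}$, $l$ the number of inversions of $\omega$. A tower diagram is a finite sequence $(\mathcal T_1,\mathcal T_2,\ldots)$ of towers; the $i$-th tower of size $k_i\ge0$ consists of the cells $(i,0),\ldots,(i,k_i-1)$, the cell $(i,j)$ being the unit square $[i-1,i]\times[j,j+1]$ identified with its south-east corner, lying on the diagonal $x+y=i+j$; $i$ is its tower (column) index. Sliding. For a positive integer $a$ and a tail $(\mathcal T_p,\ldots)$ of a tower diagram, $a^{\searrow}(\mathcal T_p,\ldots)$ either adds one cell or terminates: (S1) if no tower $\mathcal T_t$, $t\ge p$, has a cell on $x+y=a-1$: (a) if none has a cell on $x+y=a$, add $(a,0)$; (b) if $(a,0)\in\mathcal T_a$, $(a,1)\notin\mathcal T_a$, terminate; (c) if $(a,0),(a,1)\in\mathcal T_a$, result is $(a+1)^{\searrow}(\mathcal T_{a+1},\ldots)$. (S2) Otherwise, with $\mathcal T_i$ ($i\ge p$) the leftmost tower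 having a cell $(i,a-1-i)$: (a) if $(i,a-i)\notin\mathcal T_i$, add it; (b) if $(i,a-i)\in\mathcal T_i$, $(i,a-i+1)\notin\mathcal T_i$, terminate; (c) if both are in $\mathcal T_i$, result is $(a+1)^{\searrow}(\mathcal T_{i+1},\ldots)$. Sliding $a$ into $\mathcal T$ is $a^{\searrow}(\mathcal T_1,\ldots)$. The tower diagram of $\omega$ is the diagram obtained by sliding (letter by letter, into the empty diagram) any reduced word of $\omega$; it does not depend on the reduced word. Corners: a cell $c$ of a tower diagram $\mathcal T$ is a corner cell if it is the top cell of its tower and there is a positive integer $f$ (its flight number) such that sliding $f$ into $\mathcal T\setminus\{c\}$ does not terminate and yields $\mathcal T$ (this is the paper's flight algorithm, inverse to sliding). Rothe diagram: $D_\omega=\{(i,\omega_j): i<j,\ \omega_i>\omega_j\}$, $(r,c)$ meaning row $r$, column $c$. A border cell of $D_\omega$ is a cell of the form $(i,\omega_{i+1})\in D_\omega$ (these correspond to the descents $i$, $\omega_i>\omega_{i+1}$). -}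

module Defs where

open import Data.Nat using (ℕ; zero; suc; _+_; _∸_; _≤_; _<_; _<ᵇ_)
open import Data.Bool using (Bool; true; false; if_then_else_)
open import Data.List using (List; []; _∷_; length; map; upTo; foldl; filter)
open import Data.Maybe using (Maybe; just; nothing)
open import Data.Product using (Σ; ∃; _×_; _,_)
open import Data.List.Relation.Binary.Permutation.Propositional using (_↭_)
open import Relation.Binary.PropositionalEquality using (_≡_)
open import Relation.Nullary.Decidable using (⌊_⌋)
open import Data.Nat using (_<?_)

-- Permutations in one-line notation: ω = ω₁ ⋯ ωₙ as a list of naturals,
-- which must be a rearrangement of 1,…,n (n = length ω).

IsPerm : List ℕ → Set
IsPerm ω = ω ↭ map suc (upTo (length ω))

-- 1-indexed entry ω_i (0 outside the range 1..n).
ent : List ℕ → ℕ → ℕ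
ent []       _             = 0
ent (x ∷ xs) zero          = 0
ent (x ∷ xs) (suc zero)    = x
ent (x ∷ xs) (suc (suc i)) = ent xs (suc i)

-- v ↦ v s_a : swap the entries in positions a, a+1 (1-indexed).
swapAt : List ℕ → ℕ → List ℕ
swapAt (x ∷ y ∷ xs) (suc zero)    = y ∷ x ∷ xs
swapAt (x ∷ xs)     (suc (suc a)) = x ∷ swapAt xs (suc a)
swapAt xs           _             = xs

-- the product s_{α₁} ⋯ s_{α_l} in S_n, in one-line notation
wordPerm : ℕ → List ℕ → List ℕ
wordPerm n α = foldl swapAt (map suc (upTo n)) α

inv : List ℕ → ℕ
inv []       = 0
inv (x ∷ xs) = length (filter (λ y → y <? x) xs) + inv xs

data LettersIn (n : ℕ) : List ℕ → Set where
  []  : LettersIn n []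
  _∷_ : ∀ {a α} → (1 ≤ a × a < n) → LettersIn n α → LettersIn n (a ∷ α)

ReducedWord : List ℕ → List ℕ → Set
ReducedWord ω α =
  LettersIn (length ω) α × wordPerm (length ω) α ≡ ω × length α ≡ inv ω

-- Tower diagrams: a list k₁ ∷ k₂ ∷ ⋯ of tower sizes (towers beyond the
-- end of the list are empty).  Tower i (i ≥ 1) consists of the cells
-- (i,0),…,(i,k_i - 1).

size : List ℕ → ℕ → ℕ
size = ent

_∈T_ : ℕ × ℕ → List ℕ → Set
(i , j) ∈T T = 1 ≤ i × j < size T i

-- equality of tower diagrams (independent of trailing empty towers)
_≈T_ : List ℕ → List ℕ → Set
T ≈T T' = ∀ i → size T i ≡ size T' i

incr : List ℕ → ℕ → List ℕ
incr T        zero          = T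
incr []       (suc zero)    = 1 ∷ []
incr []       (suc (suc i)) = 0 ∷ incr [] (suc i)
incr (k ∷ T)  (suc zero)    = suc k ∷ T
incr (k ∷ T)  (suc (suc i)) = k ∷ incr T (suc i)

decr : List ℕ → ℕ → List ℕ
decr T        zero          = T
decr []       (suc _)       = []
decr (k ∷ T)  (suc zero)    = (k ∸ 1) ∷ T
decr (k ∷ T)  (suc (suc i)) = k ∷ decr T (suc i)

findFirst : (ℕ → Bool) → List ℕ → Maybe ℕ
findFirst P []       = nothing
findFirst P (x ∷ xs) = if P x then just x else findFirst P xs

-- leftmost tower i with p ≤ i ≤ a-1 having the cell (i , a-1-i),
-- i.e. a cell on the diagonal x+y = a-1
leftmostOnDiag : ℕ → ℕ → List ℕ → Maybe ℕ
leftmostOnDiag p a T =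
  findFirst (λ i → (a ∸ 1 ∸ i) <ᵇ size T i) (map (p +_) (upTo (a ∸ p)))

-- a↘(T_p, …) with fuel; `nothing` means "terminate", `just T'` is the
-- diagram with one added cell.  (The fuel given below is always enough:
-- p strictly increases at each recursive call and once p exceeds the
-- number of towers case (S1a) applies.)
slideGo : ℕ → ℕ → ℕ → List ℕ → Maybe (List ℕ)
slideGo zero    a p T = nothing
slideGo (suc f) a p T with leftmostOnDiag p a T
... | just i =
  if (a ∸ i) <ᵇ size T i
  then (if suc (a ∸ i) <ᵇ size T i
        then slideGo f (suc a) (suc i) T      -- (S2c)
        else nothing)                         -- (S2b)
  else just (incr T i)                        -- (S2a)
... | nothing with size T a
...   | zero         = just (incr T a)        -- (S1a)
...   | suc zero     = nothing                -- (S1b)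
...   | suc (suc _)  = slideGo f (suc a) (suc a) T   -- (S1c)

slide : ℕ → List ℕ → Maybe (List ℕ)
slide a T = slideGo (2 + length T + a) a 1 T

slideWordFrom : List ℕ → List ℕ → Maybe (List ℕ)
slideWordFrom T []      = just T
slideWordFrom T (a ∷ α) with slide a T
... | nothing = nothing
... | just T' = slideWordFrom T' α

slideWord : List ℕ → Maybe (List ℕ)
slideWord = slideWordFrom []

Corner : List ℕ → ℕ → ℕ → Set
Corner T i j =
  (i , j) ∈T T × suc j ≡ size T i ×
  Σ ℕ (λ f → 1 ≤ f × Σ (List ℕ) (λ T' → slide f (decr T i) ≡ just T' × T' ≈T T))

-- Rothe diagram D_ω = {(i , ω_j) : i < j , ω_i > ω_j}, (r , c) = (row , column)

InRothe : List ℕ → ℕ → ℕ → Set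
InRothe ω r c =
  Σ ℕ (λ j → 1 ≤ r × r < j × j ≤ length ω × ent ω j < ent ω r × c ≡ ent ω j)

Border : List ℕ → ℕ → ℕ → Set
Border ω r c = InRothe ω r c × c ≡ ent ω (suc r)

-- The tower diagram of ω is the Lehmer code of ω⁻¹: tower k has one cell for
-- each later entry of ω⁻¹ smaller than ω⁻¹_k.  Indeed, sliding an ascent a of
-- ω adds a cell to tower ω_a, which is how this code changes when the values a
-- and a + 1 of ω⁻¹ are exchanged.  In terms of the code, the top cell of tower
-- c can be removed and slid back in exactly when x = ω⁻¹_c - 1 occurs after
-- position c in ω⁻¹, i.e. when x is a descent of ω with ω_{x+1} = c; the
-- flight number is then x itself.

module Submission where

open import Defs
open import Data.Nat using (ℕ)
open import Data.List using (List)
open import Data.Maybe using (just)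
open import Data.Product using (_×_; ∃!)
open import Relation.Binary.PropositionalEquality using (_≡_)
open import Data.Bool using (true; false; if_then_else_)
open import Data.Bool.Properties using (T-≡)
open import Data.Empty using (⊥-elim)
open import Data.List using ([]; _∷_; length; map; upTo; applyUpTo; drop; filter; foldl)
open import Data.List.Properties using (map-applyUpTo; map-cong; map-∘; map-id; filter-accept; filter-reject; length-map)
open import Data.Maybe using (Maybe; nothing) renaming (map to mapᴹ)
open import Data.Maybe.Properties using (just-injective) renaming (map-cong to mapᴹ-cong)
open import Data.Nat
open import Data.Nat.Properties
open import Algebra.Properties.CommutativeSemigroup +-commutativeSemigroup using (x∙yz≈y∙xz)
open import Data.Product using (Σ; _,_; proj₁; proj₂)
open import Data.Sum using (_⊎_; inj₁; inj₂)
open import Function using (id; _∘_)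
open import Function.Bundles using (Equivalence)
open import Relation.Binary.Definitions using (tri<; tri≈; tri>)
open import Relation.Binary.PropositionalEquality
open import Relation.Nullary using (¬_; yes; no)
open import Relation.Nullary.Reflects using (ofʸ)

<ᵇ-true : ∀ {m n} → m < n → (m <ᵇ n) ≡ true
<ᵇ-true m<n = Equivalence.to T-≡ (<⇒<ᵇ m<n)

<ᵇ-false : ∀ {m n} → ¬ m < n → (m <ᵇ n) ≡ false
<ᵇ-false {m} {n} m≮n with m <ᵇ n | <ᵇ-reflects-< m n
... | true  | ofʸ m<n = ⊥-elim (m≮n m<n)
... | false | _       = refl

if-true : ∀ {A : Set} {b} {x y : A} → b ≡ true → (if b then x else y) ≡ x
if-true refl = refl

if-false : ∀ {A : Set} {b} {x y : A} → b ≡ false → (if b then x else y) ≡ y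
if-false refl = refl

-- Tower diagrams as lists of sizes

size-zero : ∀ T → size T 0 ≡ 0
size-zero []      = refl
size-zero (_ ∷ _) = refl

size-incr-same : ∀ T i → 1 ≤ i → size (incr T i) i ≡ suc (size T i)
size-incr-same []      (suc zero)    _ = refl
size-incr-same []      (suc (suc i)) _ = size-incr-same [] (suc i) (s≤s z≤n)
size-incr-same (k ∷ T) (suc zero)    _ = refl
size-incr-same (k ∷ T) (suc (suc i)) _ = size-incr-same T (suc i) (s≤s z≤n)

size-incr-other : ∀ T i m → m ≢ i → size (incr T i) m ≡ size T m
size-incr-other T       zero          m             _   = refl
size-incr-other T       (suc i)       zero          _   = trans (size-zero (incr T (suc i))) (sym (size-zero T))
size-incr-other []      (suc zero)    (suc zero)    m≢i = ⊥-elim (m≢i refl)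
size-incr-other []      (suc zero)    (suc (suc m)) _   = refl
size-incr-other []      (suc (suc i)) (suc zero)    _   = refl
size-incr-other []      (suc (suc i)) (suc (suc m)) m≢i = size-incr-other [] (suc i) (suc m) (m≢i ∘ cong suc)
size-incr-other (k ∷ T) (suc zero)    (suc zero)    m≢i = ⊥-elim (m≢i refl)
size-incr-other (k ∷ T) (suc zero)    (suc (suc m)) _   = refl
size-incr-other (k ∷ T) (suc (suc i)) (suc zero)    _   = refl
size-incr-other (k ∷ T) (suc (suc i)) (suc (suc m)) m≢i = size-incr-other T (suc i) (suc m) (m≢i ∘ cong suc)

size-decr-same : ∀ T i → size (decr T i) i ≡ size T i ∸ 1
size-decr-same T       zero          = trans (size-zero T) (cong (_∸ 1) (sym (size-zero T)))
size-decr-same []      (suc i)       = refl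
size-decr-same (k ∷ T) (suc zero)    = refl
size-decr-same (k ∷ T) (suc (suc i)) = size-decr-same T (suc i)

size-decr-other : ∀ T i m → m ≢ i → size (decr T i) m ≡ size T m
size-decr-other T       zero          m             _   = refl
size-decr-other []      (suc i)       m             _   = refl
size-decr-other (k ∷ T) (suc i)       zero          _   = size-zero (decr (k ∷ T) (suc i))
size-decr-other (k ∷ T) (suc zero)    (suc zero)    m≢i = ⊥-elim (m≢i refl)
size-decr-other (k ∷ T) (suc zero)    (suc (suc m)) _   = refl
size-decr-other (k ∷ T) (suc (suc i)) (suc zero)    _   = refl
size-decr-other (k ∷ T) (suc (suc i)) (suc (suc m)) m≢i = size-decr-other T (suc i) (suc m) (m≢i ∘ cong suc)

incr-cong : ∀ T T′ i → 1 ≤ i → T ≈T T′ → incr T i ≈T incr T′ i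
incr-cong T T′ i 1≤i T≈T′ m with m ≟ i
... | yes refl = trans (size-incr-same T m 1≤i) (trans (cong suc (T≈T′ m)) (sym (size-incr-same T′ m 1≤i)))
... | no m≢i   = trans (size-incr-other T i m m≢i) (trans (T≈T′ m) (sym (size-incr-other T′ i m m≢i)))

decr-cong : ∀ T T′ i → T ≈T T′ → decr T i ≈T decr T′ i
decr-cong T T′ i T≈T′ m with m ≟ i
... | yes refl = trans (size-decr-same T m) (trans (cong (_∸ 1) (T≈T′ m)) (sym (size-decr-same T′ m)))
... | no m≢i   = trans (size-decr-other T i m m≢i) (trans (T≈T′ m) (sym (size-decr-other T′ i m m≢i)))

decr-incr : ∀ T i → 1 ≤ i → decr (incr T i) i ≈T T
decr-incr T i 1≤i m with m ≟ i
... | yes refl = trans (size-decr-same (incr T m) m) (cong (_∸ 1) (size-incr-same T m 1≤i))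
... | no m≢i   = trans (size-decr-other (incr T i) i m m≢i) (size-incr-other T i m m≢i)

incr-decr : ∀ T i → 1 ≤ i → 1 ≤ size T i → incr (decr T i) i ≈T T
incr-decr T i 1≤i 1≤Tᵢ m with m ≟ i
... | yes refl = trans (size-incr-same (decr T m) m 1≤i) (trans (cong suc (size-decr-same T m)) (trans (+-comm 1 _) (m∸n+n≡m 1≤Tᵢ)))
... | no m≢i   = trans (size-incr-other (decr T i) i m m≢i) (size-decr-other T i m m≢i)

-- Sliding in terms of tower sizes

-- The rest of `slideGo` once p is known to be the leftmost tower meeting the
-- diagonal x+y = a-1; case (S1) is p = a.
meetTower : ℕ → ℕ → ℕ → List ℕ → Maybe (List ℕ)
meetTower f a p T =
  if (a ∸ p) <ᵇ size T p
  then (if suc (a ∸ p) <ᵇ size T p then slideGo f (suc a) (suc p) T else nothing)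
  else just (incr T p)

afterScan : ℕ → ℕ → List ℕ → Maybe ℕ → Maybe (List ℕ)
afterScan f a T (just p) = meetTower f a p T
afterScan f a T nothing  = meetTower f a a T

slideGo-unfold : ∀ f a p T → slideGo (suc f) a p T ≡ afterScan f a T (leftmostOnDiag p a T)
slideGo-unfold f a p T with leftmostOnDiag p a T
... | just _ = refl
... | nothing rewrite n∸n≡0 a with size T a
...   | zero        = refl
...   | suc zero    = refl
...   | suc (suc _) = refl

map-+-upTo-suc : ∀ p m → map (p +_) (upTo (suc m)) ≡ p ∷ map (suc p +_) (upTo m)
map-+-upTo-suc p m = cong₂ _∷_ (+-identityʳ p) (begin
  map (p +_) (applyUpTo suc m)      ≡⟨ map-applyUpTo suc (p +_) m ⟩
  applyUpTo (λ i → p + suc i) m     ≡⟨ sym (map-applyUpTo id (λ i → p + suc i) m) ⟩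
  map (λ i → p + suc i) (upTo m)    ≡⟨ map-cong (+-suc p) (upTo m) ⟩
  map (suc p +_) (upTo m)           ∎)
  where open ≡-Reasoning

leftmostOnDiag-end : ∀ a T → leftmostOnDiag a a T ≡ nothing
leftmostOnDiag-end a T rewrite n∸n≡0 a = refl

leftmostOnDiag-step : ∀ p a T → p < a →
  leftmostOnDiag p a T ≡ (if (a ∸ 1 ∸ p) <ᵇ size T p then just p else leftmostOnDiag (suc p) a T)
leftmostOnDiag-step p (suc a) T (s≤s p≤a) =
  cong (findFirst (λ i → (a ∸ i) <ᵇ size T i))
       (trans (cong (λ l → map (p +_) (upTo l)) (+-∸-assoc 1 p≤a)) (map-+-upTo-suc p (a ∸ p)))

-- Below, the letter a = suc (d + k) is slid from tower suc k, whose cell on the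
-- diagonal x+y = a has height d.

<ᵇ-height : ∀ d k n → ((d + k ∸ k) <ᵇ n) ≡ (d <ᵇ n)
<ᵇ-height d k n = cong (_<ᵇ n) (m+n∸n≡m d k)

slideGo-skip : ∀ f d k T → size T (suc k) ≤ d →
  slideGo (suc f) (suc (suc d + k)) (suc k) T ≡ slideGo (suc f) (suc (d + suc k)) (suc (suc k)) T
slideGo-skip f d k T short = begin
  slideGo (suc f) a (suc k) T                               ≡⟨ slideGo-unfold f a (suc k) T ⟩
  afterScan f a T (leftmostOnDiag (suc k) a T)              ≡⟨ cong (afterScan f a T) passes ⟩
  afterScan f a T (leftmostOnDiag (suc (suc k)) a T)        ≡⟨ slideGo-unfold f a (suc (suc k)) T ⟨
  slideGo (suc f) a (suc (suc k)) T                         ≡⟨ cong (λ x → slideGo (suc f) (suc x) (suc (suc k)) T) (+-suc d k) ⟨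
  slideGo (suc f) (suc (d + suc k)) (suc (suc k)) T         ∎
  where
  open ≡-Reasoning
  a : ℕ
  a = suc (suc d + k)
  passes : leftmostOnDiag (suc k) a T ≡ leftmostOnDiag (suc (suc k)) a T
  passes = trans (leftmostOnDiag-step (suc k) a T (s≤s (s≤s (m≤n+m k d))))
                 (if-false (trans (<ᵇ-height d k (size T (suc k))) (<ᵇ-false (≤⇒≯ short))))

slideGo-meet : ∀ f d k T → d ≤ size T (suc k) →
  slideGo (suc f) (suc (d + k)) (suc k) T ≡ meetTower f (suc (d + k)) (suc k) T
slideGo-meet f zero k T _ =
  trans (slideGo-unfold f (suc k) (suc k) T) (cong (afterScan f (suc k) T) (leftmostOnDiag-end (suc k) T))
slideGo-meet f (suc d) k T reaches =
  trans (slideGo-unfold f a (suc k) T)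
        (cong (afterScan f a T) (trans (leftmostOnDiag-step (suc k) a T (s≤s (s≤s (m≤n+m k d))))
                                       (if-true (trans (<ᵇ-height d k (size T (suc k))) (<ᵇ-true reaches)))))
  where
  a : ℕ
  a = suc (suc d + k)

meetTower-add : ∀ f d k T → size T (suc k) ≤ d →
  meetTower f (suc (d + k)) (suc k) T ≡ just (incr T (suc k))
meetTower-add f d k T short = if-false (trans (<ᵇ-height d k (size T (suc k))) (<ᵇ-false (≤⇒≯ short)))

meetTower-stop : ∀ f d k T → size T (suc k) ≡ suc d → meetTower f (suc (d + k)) (suc k) T ≡ nothing
meetTower-stop f d k T sz =
  trans (if-true (trans (<ᵇ-height d k (size T (suc k))) (<ᵇ-true (≤-reflexive (sym sz)))))
        (if-false (trans (cong (_<ᵇ size T (suc k)) (cong suc (m+n∸n≡m d k))) (<ᵇ-false (λ lt → n≮n _ (subst (suc d <_) sz lt)))))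

meetTower-climb : ∀ f d k T → suc d < size T (suc k) →
  meetTower f (suc (d + k)) (suc k) T ≡ slideGo f (suc (suc (d + k))) (suc (suc k)) T
meetTower-climb f d k T tall =
  trans (if-true (trans (<ᵇ-height d k (size T (suc k))) (<ᵇ-true (<-trans (n<1+n d) tall))))
        (if-true (trans (cong (_<ᵇ size T (suc k)) (cong suc (m+n∸n≡m d k))) (<ᵇ-true tall)))

-- Sliding read off the list of tower sizes: `slideIndex S b` is the (1-based)
-- index in S of the tower receiving the new cell, where b - 1 is the height at
-- which the current diagonal meets the first tower of S; `nothing` means that
-- the sliding terminates.
slideIndex : List ℕ → ℕ → Maybe ℕ
slideIndex []      b = just b
slideIndex (s ∷ S) b with suc s <? b
... | yes _ = mapᴹ suc (slideIndex S (pred b))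
... | no _ with s <? b
...   | yes _ = just 1
...   | no _ with b <? s
...     | yes _ = mapᴹ suc (slideIndex S b)
...     | no _  = nothing

slideIndex-below : ∀ {s b} S → suc s < b → slideIndex (s ∷ S) b ≡ mapᴹ suc (slideIndex S (pred b))
slideIndex-below {s} {b} S s+1<b with suc s <? b
... | yes _      = refl
... | no s+1≮b   = ⊥-elim (s+1≮b s+1<b)

slideIndex-onto : ∀ s S → slideIndex (s ∷ S) (suc s) ≡ just 1
slideIndex-onto s S with suc s <? suc s
... | yes s+1<s+1 = ⊥-elim (n≮n (suc s) s+1<s+1)
... | no _ with s <? suc s
...   | yes _   = refl
...   | no s≮s+1 = ⊥-elim (s≮s+1 (n<1+n s))

slideIndex-stuck : ∀ s S → slideIndex (s ∷ S) s ≡ nothing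
slideIndex-stuck s S with suc s <? s
... | yes s+1<s = ⊥-elim (n≮n s (<-trans (n<1+n s) s+1<s))
... | no _ with s <? s
...   | yes s<s′ = ⊥-elim (n≮n s s<s′)
...   | no _ with s <? s
...     | yes s<s′ = ⊥-elim (n≮n s s<s′)
...     | no _    = refl

slideIndex-above : ∀ {s b} S → b < s → slideIndex (s ∷ S) b ≡ mapᴹ suc (slideIndex S b)
slideIndex-above {s} {b} S b<s with suc s <? b
... | yes s+1<b = ⊥-elim (<-asym b<s (<-trans (n<1+n s) s+1<b))
... | no _ with s <? b
...   | yes s<b = ⊥-elim (<-asym b<s s<b)
...   | no _ with b <? s
...     | yes _   = refl
...     | no b≮s  = ⊥-elim (b≮s b<s)

drop-suc : ∀ k T {S : List ℕ} → drop k T ≡ S → drop (suc k) T ≡ drop 1 S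
drop-suc zero    T       refl = refl
drop-suc (suc k) []      refl = refl
drop-suc (suc k) (_ ∷ T) e    = drop-suc k T e

size-drop : ∀ T k {S} → drop k T ≡ S → size T (suc k) ≡ size S 1
size-drop []      zero    refl = refl
size-drop []      (suc k) refl = refl
size-drop (_ ∷ T) zero    refl = refl
size-drop (_ ∷ T) (suc k) e    = size-drop T k e

mapᴹ-incr-shift : ∀ T k (X : Maybe ℕ) →
  mapᴹ (λ u → incr T (u + suc k)) X ≡ mapᴹ (λ u → incr T (u + k)) (mapᴹ suc X)
mapᴹ-incr-shift T k (just u) = cong (λ v → just (incr T v)) (+-suc u k)
mapᴹ-incr-shift T k nothing  = refl

slideGo-pass : ∀ f d k T X → size T (suc k) ≤ d →
  slideGo (suc f) (suc (d + suc k)) (suc (suc k)) T ≡ mapᴹ (λ u → incr T (u + suc k)) X →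
  slideGo (suc f) (suc (suc d + k)) (suc k) T ≡ mapᴹ (λ u → incr T (u + k)) (mapᴹ suc X)
slideGo-pass f d k T X short next =
  trans (slideGo-skip f d k T short) (trans next (mapᴹ-incr-shift T k X))

slideGo-climb : ∀ f d k T X → suc d < size T (suc k) →
  slideGo f (suc (d + suc k)) (suc (suc k)) T ≡ mapᴹ (λ u → incr T (u + suc k)) X →
  slideGo (suc f) (suc (d + k)) (suc k) T ≡ mapᴹ (λ u → incr T (u + k)) (mapᴹ suc X)
slideGo-climb f d k T X tall next = begin
  slideGo (suc f) (suc (d + k)) (suc k) T              ≡⟨ slideGo-meet f d k T (<⇒≤ (<-trans (n<1+n d) tall)) ⟩
  meetTower f (suc (d + k)) (suc k) T                  ≡⟨ meetTower-climb f d k T tall ⟩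
  slideGo f (suc (suc (d + k))) (suc (suc k)) T        ≡⟨ cong (λ x → slideGo f (suc x) (suc (suc k)) T) (+-suc d k) ⟨
  slideGo f (suc (d + suc k)) (suc (suc k)) T          ≡⟨ next ⟩
  mapᴹ (λ u → incr T (u + suc k)) X                    ≡⟨ mapᴹ-incr-shift T k X ⟩
  mapᴹ (λ u → incr T (u + k)) (mapᴹ suc X)             ∎
  where open ≡-Reasoning

slideGo-slideIndex : ∀ S k T → drop k T ≡ S → ∀ d f → length S ≤ f →
  slideGo (suc f) (suc (d + k)) (suc k) T ≡ mapᴹ (λ u → incr T (u + k)) (slideIndex S (suc d))
slideGo-slideIndex [] k T e zero f _ =
  trans (slideGo-meet f 0 k T z≤n) (meetTower-add f 0 k T (≤-reflexive (size-drop T k e)))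
slideGo-slideIndex [] k T e (suc d) f l =
  slideGo-pass f d k T (just (suc d)) (≤-trans (≤-reflexive (size-drop T k e)) z≤n)
    (slideGo-slideIndex [] (suc k) T (drop-suc k T e) d f l)
slideGo-slideIndex (s ∷ S) k T e d (suc f) (s≤s l) with <-cmp s d
slideGo-slideIndex (s ∷ S) k T e (suc d) (suc f) (s≤s l) | tri< (s≤s s≤d) _ _ =
  trans (slideGo-pass (suc f) d k T (slideIndex S (suc d)) (≤-trans (≤-reflexive (size-drop T k e)) s≤d)
                      (slideGo-slideIndex S (suc k) T (drop-suc k T e) d (suc f) (m≤n⇒m≤1+n l)))
        (cong (mapᴹ (λ u → incr T (u + k))) (sym (slideIndex-below S (s≤s (s≤s s≤d)))))
... | tri≈ _ refl _ =
  trans (slideGo-meet (suc f) s k T (≤-reflexive (sym (size-drop T k e))))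
        (trans (meetTower-add (suc f) s k T (≤-reflexive (size-drop T k e)))
               (cong (mapᴹ (λ u → incr T (u + k))) (sym (slideIndex-onto s S))))
... | tri> _ _ d<s with m≤n⇒m<n∨m≡n d<s
...   | inj₂ refl =
  trans (slideGo-meet (suc f) d k T (≤-trans (n≤1+n d) (≤-reflexive (sym (size-drop T k e)))))
        (trans (meetTower-stop (suc f) d k T (size-drop T k e))
               (cong (mapᴹ (λ u → incr T (u + k))) (sym (slideIndex-stuck (suc d) S))))
...   | inj₁ d+1<s =
  trans (slideGo-climb (suc f) d k T (slideIndex S (suc d)) (≤-trans d+1<s (≤-reflexive (sym (size-drop T k e))))
                       (slideGo-slideIndex S (suc k) T (drop-suc k T e) d f l))
        (cong (mapᴹ (λ u → incr T (u + k))) (sym (slideIndex-above S d+1<s)))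

slide-slideIndex : ∀ d T → slide (suc d) T ≡ mapᴹ (incr T) (slideIndex T (suc d))
slide-slideIndex d T = begin
  slideGo (suc (suc (length T + suc d))) (suc d) 1 T
    ≡⟨ cong (λ x → slideGo (suc (suc (length T + suc d))) (suc x) 1 T) (+-identityʳ d) ⟨
  slideGo (suc (suc (length T + suc d))) (suc (d + 0)) 1 T
    ≡⟨ slideGo-slideIndex T 0 T refl d _ (≤-trans (m≤m+n (length T) (suc d)) (n≤1+n _)) ⟩
  mapᴹ (λ u → incr T (u + 0)) (slideIndex T (suc d))
    ≡⟨ mapᴹ-cong (λ u → cong (incr T) (+-identityʳ u)) (slideIndex T (suc d)) ⟩
  mapᴹ (incr T) (slideIndex T (suc d)) ∎
  where open ≡-Reasoning

≈T-tail : ∀ {s s′ S S′} → (s ∷ S) ≈T (s′ ∷ S′) → S ≈T S′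
≈T-tail {S = S} {S′} _ zero    = trans (size-zero S) (sym (size-zero S′))
≈T-tail              h (suc i) = h (suc (suc i))

slideIndex-flat : ∀ S b → S ≈T [] → 1 ≤ b → slideIndex S b ≡ just b
slideIndex-flat []      b             _    _ = refl
slideIndex-flat (s ∷ S) b             flat _ with flat 1
slideIndex-flat (0 ∷ S) (suc zero)    flat _ | refl = slideIndex-onto 0 S
slideIndex-flat (0 ∷ S) (suc (suc b)) flat _ | refl =
  trans (slideIndex-below S (s≤s (s≤s z≤n)))
        (cong (mapᴹ suc) (slideIndex-flat S (suc b) (λ { zero → size-zero S ; (suc i) → flat (suc (suc i)) }) (s≤s z≤n)))

slideIndex-cong : ∀ S S′ b → S ≈T S′ → 1 ≤ b → slideIndex S b ≡ slideIndex S′ b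
slideIndex-cong []      []       b _    _  = refl
slideIndex-cong []      (s ∷ S′) b S≈S′ 1≤b = sym (slideIndex-flat (s ∷ S′) b (λ i → sym (S≈S′ i)) 1≤b)
slideIndex-cong (s ∷ S) []       b S≈S′ 1≤b = slideIndex-flat (s ∷ S) b S≈S′ 1≤b
slideIndex-cong (s ∷ S) (s′ ∷ S′) b S≈S′ 1≤b with S≈S′ 1
... | refl with suc s <? b
...   | yes s+1<b = cong (mapᴹ suc) (slideIndex-cong S S′ (pred b) (≈T-tail S≈S′) (≤-trans (s≤s z≤n) (pred-mono-≤ s+1<b)))
...   | no _ with s <? b
...     | yes _ = refl
...     | no _ with b <? s
...       | yes _ = cong (mapᴹ suc) (slideIndex-cong S S′ b (≈T-tail S≈S′) 1≤b)
...       | no _  = refl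

-- Lehmer codes

countBelow : ℕ → List ℕ → ℕ
countBelow t L = length (filter (_<? t) L)

occurrences : ℕ → List ℕ → ℕ
occurrences v L = length (filter (_≟ v) L)

countBelow-< : ∀ {t x} L → x < t → countBelow t (x ∷ L) ≡ suc (countBelow t L)
countBelow-< {t} L x<t = cong length (filter-accept (_<? t) x<t)

countBelow-≮ : ∀ {t x} L → ¬ x < t → countBelow t (x ∷ L) ≡ countBelow t L
countBelow-≮ {t} L x≮t = cong length (filter-reject (_<? t) x≮t)

occurrences-≡ : ∀ {v x} L → x ≡ v → occurrences v (x ∷ L) ≡ suc (occurrences v L)
occurrences-≡ {v} L x≡v = cong length (filter-accept (_≟ v) x≡v)

occurrences-≢ : ∀ {v x} L → x ≢ v → occurrences v (x ∷ L) ≡ occurrences v L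
occurrences-≢ {v} L x≢v = cong length (filter-reject (_≟ v) x≢v)

occurrences-∷ : ∀ v x L → occurrences v L ≤ occurrences v (x ∷ L)
occurrences-∷ v x L with x ≟ v
... | yes x≡v = ≤-trans (n≤1+n _) (≤-reflexive (sym (occurrences-≡ L x≡v)))
... | no x≢v  = ≤-reflexive (sym (occurrences-≢ L x≢v))

countBelow-zero : ∀ L → countBelow 0 L ≡ 0
countBelow-zero []      = refl
countBelow-zero (x ∷ L) = trans (countBelow-≮ {0} {x} L n≮0) (countBelow-zero L)

countBelow-suc : ∀ v L → countBelow (suc v) L ≡ countBelow v L + occurrences v L
countBelow-suc v []      = refl
countBelow-suc v (x ∷ L) with <-cmp x v
... | tri< x<v x≢v _ = begin
  countBelow (suc v) (x ∷ L)                    ≡⟨ countBelow-< L (m<n⇒m<1+n x<v) ⟩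
  suc (countBelow (suc v) L)                    ≡⟨ cong suc (countBelow-suc v L) ⟩
  suc (countBelow v L + occurrences v L)        ≡⟨ cong₂ _+_ (countBelow-< L x<v) (occurrences-≢ L x≢v) ⟨
  countBelow v (x ∷ L) + occurrences v (x ∷ L)  ∎
  where open ≡-Reasoning
... | tri≈ _ x≡v _ = begin
  countBelow (suc v) (x ∷ L)                    ≡⟨ countBelow-< L (≤-reflexive (cong suc x≡v)) ⟩
  suc (countBelow (suc v) L)                    ≡⟨ cong suc (countBelow-suc v L) ⟩
  suc (countBelow v L + occurrences v L)        ≡⟨ +-suc _ _ ⟨
  countBelow v L + suc (occurrences v L)        ≡⟨ cong₂ _+_ (countBelow-≮ L (<-irrefl x≡v)) (occurrences-≡ L x≡v) ⟨
  countBelow v (x ∷ L) + occurrences v (x ∷ L)  ∎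
  where open ≡-Reasoning
... | tri> _ x≢v v<x = begin
  countBelow (suc v) (x ∷ L)                    ≡⟨ countBelow-≮ L (≤⇒≯ v<x) ⟩
  countBelow (suc v) L                          ≡⟨ countBelow-suc v L ⟩
  countBelow v L + occurrences v L              ≡⟨ cong₂ _+_ (countBelow-≮ L (<⇒≯ v<x)) (occurrences-≢ L x≢v) ⟨
  countBelow v (x ∷ L) + occurrences v (x ∷ L)  ∎
  where open ≡-Reasoning

countBelow-mono : ∀ L {u v} → u ≤ v → countBelow u L ≤ countBelow v L
countBelow-mono L u≤v = go (≤⇒≤′ u≤v)
  where
  go : ∀ {u v} → u ≤′ v → countBelow u L ≤ countBelow v L
  go ≤′-refl               = ≤-refl
  go (≤′-step {n = v} u≤v) = ≤-trans (go u≤v) (≤-trans (m≤m+n _ _) (≤-reflexive (sym (countBelow-suc v L))))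

countBelow-across : ∀ L {u w v} → u ≤ w → w < v → 0 < occurrences w L → countBelow u L < countBelow v L
countBelow-across L {u} {w} {v} u≤w w<v w∈L = begin-strict
  countBelow u L                    ≤⟨ countBelow-mono L u≤w ⟩
  countBelow w L                    <⟨ m<m+n _ w∈L ⟩
  countBelow w L + occurrences w L  ≡⟨ countBelow-suc w L ⟨
  countBelow (suc w) L              ≤⟨ countBelow-mono L w<v ⟩
  countBelow v L                    ∎
  where open ≤-Reasoning

lehmer : List ℕ → List ℕ
lehmer []      = []
lehmer (q ∷ P) = countBelow q P ∷ lehmer P

indexBeforeSuc : ℕ → List ℕ → Maybe ℕ
indexBeforeSuc a []      = nothing
indexBeforeSuc a (q ∷ P) with q ≟ a
... | yes _ = just 1
... | no _ with q ≟ suc a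
...   | yes _ = nothing
...   | no _  = mapᴹ suc (indexBeforeSuc a P)

indexBeforeSuc-here : ∀ {q a} P → q ≡ a → indexBeforeSuc a (q ∷ P) ≡ just 1
indexBeforeSuc-here {q} {a} P q≡a with q ≟ a
... | yes _  = refl
... | no q≢a = ⊥-elim (q≢a q≡a)

indexBeforeSuc-blocked : ∀ {a} P → indexBeforeSuc a (suc a ∷ P) ≡ nothing
indexBeforeSuc-blocked {a} P with suc a ≟ a
... | yes a+1≡a = ⊥-elim (1+n≢n a+1≡a)
... | no _ with suc a ≟ suc a
...   | yes _   = refl
...   | no ≢refl = ⊥-elim (≢refl refl)

indexBeforeSuc-there : ∀ {q a} P → q ≢ a → q ≢ suc a → indexBeforeSuc a (q ∷ P) ≡ mapᴹ suc (indexBeforeSuc a P)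
indexBeforeSuc-there {q} {a} P q≢a q≢a+1 with q ≟ a
... | yes q≡a = ⊥-elim (q≢a q≡a)
... | no _ with q ≟ suc a
...   | yes q≡a+1 = ⊥-elim (q≢a+1 q≡a+1)
...   | no _      = refl

slideIndex-lehmer-smaller : ∀ {q a} P → q < a → 0 < occurrences a P →
  slideIndex (lehmer (q ∷ P)) (countBelow (suc a) (q ∷ P)) ≡ mapᴹ suc (slideIndex (lehmer P) (countBelow (suc a) P))
slideIndex-lehmer-smaller {q} {a} P q<a a∈P = begin
  slideIndex (countBelow q P ∷ lehmer P) (countBelow (suc a) (q ∷ P))
    ≡⟨ cong (slideIndex (countBelow q P ∷ lehmer P)) (countBelow-< P (m<n⇒m<1+n q<a)) ⟩
  slideIndex (countBelow q P ∷ lehmer P) (suc (countBelow (suc a) P))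
    ≡⟨ slideIndex-below (lehmer P) (s≤s (countBelow-across P (<⇒≤ q<a) (n<1+n a) a∈P)) ⟩
  mapᴹ suc (slideIndex (lehmer P) (countBelow (suc a) P)) ∎
  where open ≡-Reasoning

slideIndex-lehmer-at : ∀ a P → occurrences a P ≡ 0 → slideIndex (lehmer (a ∷ P)) (countBelow (suc a) (a ∷ P)) ≡ just 1
slideIndex-lehmer-at a P a∉P = begin
  slideIndex (countBelow a P ∷ lehmer P) (countBelow (suc a) (a ∷ P))
    ≡⟨ cong (slideIndex (countBelow a P ∷ lehmer P)) (trans (countBelow-< P (n<1+n a)) (cong suc no-gap)) ⟩
  slideIndex (countBelow a P ∷ lehmer P) (suc (countBelow a P))
    ≡⟨ slideIndex-onto (countBelow a P) (lehmer P) ⟩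
  just 1 ∎
  where
  open ≡-Reasoning
  no-gap : countBelow (suc a) P ≡ countBelow a P
  no-gap = trans (countBelow-suc a P) (trans (cong (countBelow a P +_) a∉P) (+-identityʳ _))

slideIndex-lehmer-blocked : ∀ a P → slideIndex (lehmer (suc a ∷ P)) (countBelow (suc a) (suc a ∷ P)) ≡ nothing
slideIndex-lehmer-blocked a P =
  trans (cong (slideIndex (countBelow (suc a) P ∷ lehmer P)) (countBelow-≮ P (n≮n (suc a))))
        (slideIndex-stuck (countBelow (suc a) P) (lehmer P))

slideIndex-lehmer-larger : ∀ {q a} P → suc a < q → 0 < occurrences (suc a) P →
  slideIndex (lehmer (q ∷ P)) (countBelow (suc a) (q ∷ P)) ≡ mapᴹ suc (slideIndex (lehmer P) (countBelow (suc a) P))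
slideIndex-lehmer-larger {q} {a} P a+1<q a+1∈P =
  trans (cong (slideIndex (countBelow q P ∷ lehmer P)) (countBelow-≮ P (<⇒≯ a+1<q)))
        (slideIndex-above (lehmer P) (countBelow-across P ≤-refl a+1<q a+1∈P))

-- For a permutation P the flight countBelow (suc a) P is just a.
slideIndex-lehmer : ∀ P a → occurrences a P ≡ 1 → occurrences (suc a) P ≡ 1 →
  slideIndex (lehmer P) (countBelow (suc a) P) ≡ indexBeforeSuc a P
slideIndex-lehmer (q ∷ P) a a∈ a+1∈ with <-cmp q a
... | tri< q<a q≢a _ =
  trans (slideIndex-lehmer-smaller P q<a (≤-reflexive (sym a∈P)))
        (trans (cong (mapᴹ suc) (slideIndex-lehmer P a a∈P a+1∈P)) (sym (indexBeforeSuc-there P q≢a q≢a+1)))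
  where
  q≢a+1 : q ≢ suc a
  q≢a+1 = <⇒≢ (m<n⇒m<1+n q<a)
  a∈P : occurrences a P ≡ 1
  a∈P = trans (sym (occurrences-≢ P q≢a)) a∈
  a+1∈P : occurrences (suc a) P ≡ 1
  a+1∈P = trans (sym (occurrences-≢ P q≢a+1)) a+1∈
... | tri≈ _ refl _ =
  trans (slideIndex-lehmer-at q P (suc-injective (trans (sym (occurrences-≡ P refl)) a∈))) (sym (indexBeforeSuc-here {q} P refl))
... | tri> _ _ a<q with q ≟ suc a
...   | yes refl = trans (slideIndex-lehmer-blocked a P) (sym (indexBeforeSuc-blocked {a} P))
...   | no q≢a+1 =
  trans (slideIndex-lehmer-larger P (≤∧≢⇒< a<q (q≢a+1 ∘ sym)) (≤-reflexive (sym a+1∈P)))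
        (trans (cong (mapᴹ suc) (slideIndex-lehmer P a a∈P a+1∈P)) (sym (indexBeforeSuc-there P (>⇒≢ a<q) q≢a+1)))
  where
  a∈P : occurrences a P ≡ 1
  a∈P = trans (sym (occurrences-≢ P (>⇒≢ a<q))) a∈
  a+1∈P : occurrences (suc a) P ≡ 1
  a+1∈P = trans (sym (occurrences-≢ P q≢a+1)) a+1∈

mapᴹ-suc-just : ∀ (X : Maybe ℕ) {k} → mapᴹ suc X ≡ just k → Σ ℕ (λ k′ → X ≡ just k′ × k ≡ suc k′)
mapᴹ-suc-just (just k′) refl = k′ , refl , refl

indexBeforeSuc-pos : ∀ a P {k} → indexBeforeSuc a P ≡ just k → 1 ≤ k
indexBeforeSuc-pos a (q ∷ P) e with q ≟ a
... | yes _ = ≤-reflexive (just-injective e)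
... | no _ with q ≟ suc a
...   | no _ with mapᴹ-suc-just (indexBeforeSuc a P) e
...     | _ , _ , refl = s≤s z≤n

swapVal : ℕ → ℕ → ℕ
swapVal a x with x ≟ a
... | yes _ = suc a
... | no _ with x ≟ suc a
...   | yes _ = a
...   | no _  = x

swapVal-left : ∀ a → swapVal a a ≡ suc a
swapVal-left a with a ≟ a
... | yes _    = refl
... | no ≢refl = ⊥-elim (≢refl refl)

swapVal-right : ∀ a → swapVal a (suc a) ≡ a
swapVal-right a with suc a ≟ a
... | yes a+1≡a = ⊥-elim (1+n≢n a+1≡a)
... | no _ with suc a ≟ suc a
...   | yes _    = refl
...   | no ≢refl = ⊥-elim (≢refl refl)

swapVal-fixed : ∀ {a x} → x ≢ a → x ≢ suc a → swapVal a x ≡ x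
swapVal-fixed {a} {x} x≢a x≢a+1 with x ≟ a
... | yes x≡a = ⊥-elim (x≢a x≡a)
... | no _ with x ≟ suc a
...   | yes x≡a+1 = ⊥-elim (x≢a+1 x≡a+1)
...   | no _      = refl

swapVal-involutive : ∀ a x → swapVal a (swapVal a x) ≡ x
swapVal-involutive a x with x ≟ a
... | yes refl = swapVal-right x
... | no x≢a with x ≟ suc a
...   | yes refl  = swapVal-left a
...   | no x≢a+1  = swapVal-fixed x≢a x≢a+1

swapVal-reflect-< : ∀ {a t} y → t ≢ suc a → swapVal a y < t → y < t
swapVal-reflect-< {a} {t} y t≢a+1 with y ≟ a
... | yes refl = <-trans (n<1+n y)
... | no _ with y ≟ suc a
...   | yes refl = λ a<t → ≤∧≢⇒< a<t (t≢a+1 ∘ sym)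
...   | no _     = id

countBelow-map : ∀ {t} f L → (∀ y → f y < t → y < t) → (∀ y → y < t → f y < t) →
  countBelow t (map f L) ≡ countBelow t L
countBelow-map     f []      _       _       = refl
countBelow-map {t} f (y ∷ L) reflect preserve with y <? t
... | yes y<t = trans (countBelow-< (map f L) (preserve y y<t))
                      (trans (cong suc (countBelow-map f L reflect preserve)) (sym (countBelow-< L y<t)))
... | no y≮t  = trans (countBelow-≮ (map f L) (y≮t ∘ reflect y))
                      (trans (countBelow-map f L reflect preserve) (sym (countBelow-≮ L y≮t)))

countBelow-swapVal : ∀ {a t} L → t ≢ suc a → countBelow t (map (swapVal a) L) ≡ countBelow t L
countBelow-swapVal {a} L t≢a+1 = countBelow-map (swapVal a) L
  (λ y → swapVal-reflect-< y t≢a+1)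
  (λ y y<t → swapVal-reflect-< (swapVal a y) t≢a+1 (subst (_< _) (sym (swapVal-involutive a y)) y<t))

occurrences-swapVal : ∀ a v L → occurrences v (map (swapVal a) L) ≡ occurrences (swapVal a v) L
occurrences-swapVal a v []      = refl
occurrences-swapVal a v (y ∷ L) with y ≟ swapVal a v
... | yes y≡v′ = trans (occurrences-≡ (map (swapVal a) L) (trans (cong (swapVal a) y≡v′) (swapVal-involutive a v)))
                       (trans (cong suc (occurrences-swapVal a v L)) (sym (occurrences-≡ L y≡v′)))
... | no y≢v′  = trans (occurrences-≢ {v} {swapVal a y} (map (swapVal a) L) (λ e → y≢v′ (trans (sym (swapVal-involutive a y)) (cong (swapVal a) e))))
                       (trans (occurrences-swapVal a v L) (sym (occurrences-≢ L y≢v′)))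

countBelow-suc-swapVal : ∀ a L → countBelow (suc a) (map (swapVal a) L) ≡ countBelow a L + occurrences (suc a) L
countBelow-suc-swapVal a L = begin
  countBelow (suc a) (map (swapVal a) L)
    ≡⟨ countBelow-suc a (map (swapVal a) L) ⟩
  countBelow a (map (swapVal a) L) + occurrences a (map (swapVal a) L)
    ≡⟨ cong₂ _+_ (countBelow-swapVal L (1+n≢n ∘ sym)) (occurrences-swapVal a a L) ⟩
  countBelow a L + occurrences (swapVal a a) L
    ≡⟨ cong (λ v → countBelow a L + occurrences v L) (swapVal-left a) ⟩
  countBelow a L + occurrences (suc a) L ∎
  where open ≡-Reasoning

map-swapVal-involutive : ∀ a P → map (swapVal a) (map (swapVal a) P) ≡ P
map-swapVal-involutive a P = trans (sym (map-∘ P)) (trans (map-cong (swapVal-involutive a) P) (map-id P))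

-- The case splits below are those of `swapVal`, so its applications reduce in each branch.
lehmer-swapVal-absent : ∀ a L → occurrences a L ≡ 0 → lehmer (map (swapVal a) L) ≡ lehmer L
lehmer-swapVal-absent a []      _   = refl
lehmer-swapVal-absent a (y ∷ L) a∉ with y ≟ a
... | yes y≡a = ⊥-elim (1+n≢0 (trans (sym (occurrences-≡ L y≡a)) a∉))
... | no y≢a with y ≟ suc a
...   | yes refl = cong₂ _∷_ (begin
  countBelow a (map (swapVal a) L)      ≡⟨ countBelow-swapVal L (1+n≢n ∘ sym) ⟩
  countBelow a L                        ≡⟨ +-identityʳ _ ⟨
  countBelow a L + 0                    ≡⟨ cong (countBelow a L +_) a∉L ⟨
  countBelow a L + occurrences a L      ≡⟨ countBelow-suc a L ⟨
  countBelow (suc a) L                  ∎) (lehmer-swapVal-absent a L a∉L)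
  where
  open ≡-Reasoning
  a∉L : occurrences a L ≡ 0
  a∉L = trans (sym (occurrences-≢ L y≢a)) a∉
...   | no y≢a+1 = cong₂ _∷_ (countBelow-swapVal L y≢a+1) (lehmer-swapVal-absent a L (trans (sym (occurrences-≢ L y≢a)) a∉))

lehmer-swapVal : ∀ a L {k} → occurrences a L ≡ 1 → occurrences (suc a) L ≡ 1 → indexBeforeSuc a L ≡ just k →
  lehmer (map (swapVal a) L) ≡ incr (lehmer L) k
lehmer-swapVal a (y ∷ L) a∈ a+1∈ first with y ≟ a
... | yes refl with first
...   | refl = cong₂ _∷_ (begin
  countBelow (suc y) (map (swapVal y) L)         ≡⟨ countBelow-suc-swapVal y L ⟩
  countBelow y L + occurrences (suc y) L         ≡⟨ cong (countBelow y L +_) (trans (sym (occurrences-≢ L (1+n≢n ∘ sym))) a+1∈) ⟩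
  countBelow y L + 1                             ≡⟨ +-comm _ 1 ⟩
  suc (countBelow y L)                           ∎) (lehmer-swapVal-absent y L (suc-injective (trans (sym (occurrences-≡ L refl)) a∈)))
  where open ≡-Reasoning
lehmer-swapVal a (y ∷ L) a∈ a+1∈ first | no y≢a with y ≟ suc a
...   | yes refl with () ← first
...   | no y≢a+1 with mapᴹ-suc-just (indexBeforeSuc a L) first
...     | suc k′ , first′ , refl = cong₂ _∷_ (countBelow-swapVal L y≢a+1)
  (lehmer-swapVal a L (trans (sym (occurrences-≢ L y≢a)) a∈) (trans (sym (occurrences-≢ L y≢a+1)) a+1∈) first′)
...     | zero , first′ , refl = ⊥-elim (n≮n 0 (indexBeforeSuc-pos a L first′))

-- Reading a flight backwards

data SlideIndexStep (s : ℕ) (S : List ℕ) (b u : ℕ) : Set where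
  below : suc s < b → ∀ {u′} → slideIndex S (pred b) ≡ just u′ → u ≡ suc u′ → SlideIndexStep s S b u
  onto  : b ≡ suc s → u ≡ 1 → SlideIndexStep s S b u
  above : b < s → ∀ {u′} → slideIndex S b ≡ just u′ → u ≡ suc u′ → SlideIndexStep s S b u

slideIndex-step : ∀ s S b {u} → slideIndex (s ∷ S) b ≡ just u → SlideIndexStep s S b u
slideIndex-step s S b e with <-cmp (suc s) b
... | tri< s+1<b _ _ with mapᴹ-suc-just (slideIndex S (pred b)) (trans (sym (slideIndex-below S s+1<b)) e)
...   | _ , e′ , refl = below s+1<b e′ refl
slideIndex-step s S b e | tri≈ _ refl _ = onto refl (just-injective (trans (sym e) (slideIndex-onto s S)))
slideIndex-step s S b e | tri> _ _ b<s+1 with m≤n⇒m<n∨m≡n (≤-pred b<s+1)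
... | inj₁ b<s with mapᴹ-suc-just (slideIndex S b) (trans (sym (slideIndex-above S b<s)) e)
...   | _ , e′ , refl = above b<s e′ refl
slideIndex-step s S b e | tri> _ _ _ | inj₂ refl with () ← trans (sym (slideIndex-stuck s S)) e

slideIndex-pos : ∀ S b {u} → 1 ≤ b → slideIndex S b ≡ just u → 1 ≤ u
slideIndex-pos []      b 1≤b refl = 1≤b
slideIndex-pos (s ∷ S) b _   e with slideIndex-step s S b e
... | below _ _ refl = s≤s z≤n
... | onto _ refl    = s≤s z≤n
... | above _ _ refl = s≤s z≤n

Distinct : List ℕ → Set
Distinct L = ∀ v → occurrences v L ≤ 1

distinct-tail : ∀ {q L} → Distinct (q ∷ L) → Distinct L
distinct-tail {q} {L} distinct v = ≤-trans (occurrences-∷ v q L) (distinct v)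

NoneBetween : ℕ → ℕ → List ℕ → Set
NoneBetween x y L = ∀ z → x < z → z < y → occurrences z L ≡ 0

countBelow-gap : ∀ L {x q} → NoneBetween x q L → x < q → countBelow (suc x) L ≡ countBelow q L
countBelow-gap L {x} {suc q} gap (s≤s x≤q) with m≤n⇒m<n∨m≡n x≤q
... | inj₂ refl = refl
... | inj₁ x<q  = begin
  countBelow (suc x) L              ≡⟨ countBelow-gap L (λ z x<z z<q → gap z x<z (m<n⇒m<1+n z<q)) x<q ⟩
  countBelow q L                    ≡⟨ +-identityʳ _ ⟨
  countBelow q L + 0                ≡⟨ cong (countBelow q L +_) (gap q x<q (n<1+n q)) ⟨
  countBelow q L + occurrences q L  ≡⟨ countBelow-suc q L ⟨
  countBelow (suc q) L              ∎
  where open ≡-Reasoning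

largestBelow : ∀ q L → 1 ≤ countBelow q L → Σ ℕ (λ x → x < q × 1 ≤ occurrences x L × NoneBetween x q L)
largestBelow zero    L h = ⊥-elim (1+n≰n (≤-trans h (≤-reflexive (countBelow-zero L))))
largestBelow (suc q) L h with occurrences q L in q∈L
... | suc _ = q , n<1+n q , ≤-trans (s≤s z≤n) (≤-reflexive (sym q∈L)) , λ z q<z z<q+1 → ⊥-elim (<⇒≱ q<z (≤-pred z<q+1))
... | zero with largestBelow q L (≤-trans h (≤-reflexive (trans (countBelow-suc q L) (trans (cong (countBelow q L +_) q∈L) (+-identityʳ _)))))
...   | x , x<q , x∈L , gap = x , m<n⇒m<1+n x<q , x∈L , gap′
  where
  gap′ : NoneBetween x (suc q) L
  gap′ z x<z z<q+1 with m≤n⇒m<n∨m≡n (≤-pred z<q+1)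
  ... | inj₁ z<q  = gap z x<z z<q
  ... | inj₂ refl = q∈L

lehmer-pos-occurs : ∀ L k → 1 ≤ size (lehmer L) (suc k) → 1 ≤ occurrences (ent L (suc k)) L
lehmer-pos-occurs (q ∷ L) zero    _ = subst (1 ≤_) (sym (occurrences-≡ {q} L refl)) (s≤s z≤n)
lehmer-pos-occurs (q ∷ L) (suc k) h = ≤-trans (lehmer-pos-occurs L k h) (occurrences-∷ _ q L)

noneBetween-∷ : ∀ {x y} q L → q ≤ x ⊎ y ≤ q → NoneBetween x y L → NoneBetween x y (q ∷ L)
noneBetween-∷ q L (inj₁ q≤x) gap z x<z z<y =
  trans (occurrences-≢ {x = q} L (λ { refl → <⇒≱ x<z q≤x })) (gap z x<z z<y)
noneBetween-∷ q L (inj₂ y≤q) gap z x<z z<y =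
  trans (occurrences-≢ {x = q} L (λ { refl → <⇒≱ z<y y≤q })) (gap z x<z z<y)

-- A flight b returning the top cell of tower i + 1 of `lehmer P` to its place
-- determines the largest value x < P_{i+1} occurring in P after position i + 1.
record Landing (P : List ℕ) (i b : ℕ) : Set where
  constructor landing
  field
    value   : ℕ
    value<  : value < ent P (suc i)
    later   : 1 ≤ occurrences value (drop (suc i) P)
    gap     : NoneBetween value (ent P (suc i)) P
    flight  : countBelow (suc value) P ≡ b

landing-head : ∀ q L {b} → 1 ≤ countBelow q L → b ≡ countBelow q L → Landing (q ∷ L) 0 b
landing-head q L h refl with largestBelow q L h
... | x , x<q , x∈L , gap = landing x x<q x∈L (noneBetween-∷ q L (inj₂ ≤-refl) gap)
  (trans (countBelow-≮ L (<⇒≱ x<q ∘ ≤-pred)) (countBelow-gap L gap x<q))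

landing-below : ∀ {q L i b} → suc (countBelow q L) < b → Landing L i (pred b) → Landing (q ∷ L) (suc i) b
landing-below {q} {L} {i} {b} tall (landing x x< x∈ gap flight) with q <? suc x
... | yes q≤x = landing x x< x∈ (noneBetween-∷ q L (inj₁ (≤-pred q≤x)) gap)
  (trans (countBelow-< L q≤x) (trans (cong suc flight) (suc-pred b ⦃ >-nonZero (<-trans z<s tall) ⦄)))
... | no q≰x = ⊥-elim (<⇒≱ tall (begin
  b                           ≡⟨ suc-pred b ⦃ >-nonZero (<-trans z<s tall) ⦄ ⟨
  suc (pred b)                ≡⟨ cong suc flight ⟨
  suc (countBelow (suc x) L)  ≤⟨ s≤s (countBelow-mono L (≮⇒≥ q≰x)) ⟩
  suc (countBelow q L)        ∎))
  where open ≤-Reasoning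

landing-above : ∀ {q L i b} → Distinct (q ∷ L) → 1 ≤ size (lehmer L) (suc i) → b < countBelow q L →
  Landing L i b → Landing (q ∷ L) (suc i) b
landing-above {q} {L} {i} {b} distinct h short (landing x x<y x∈ gap flight) with <-cmp q (ent L (suc i))
... | tri≈ _ refl _ = ⊥-elim (1+n≰n (≤-trans (lehmer-pos-occurs L i h) (≤-reflexive q∉L)))
  where
  q∉L : occurrences q L ≡ 0
  q∉L = n≤0⇒n≡0 (≤-pred (≤-trans (≤-reflexive (sym (occurrences-≡ L refl))) (distinct q)))
... | tri< q<y _ _ with q <? suc x
...   | yes q≤x = ⊥-elim (<⇒≱ short (≤-trans (countBelow-mono L (<⇒≤ q≤x)) (≤-reflexive flight)))
...   | no q≰x  = ⊥-elim (<⇒≢ short (trans (sym flight)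
                    (countBelow-gap L (λ z x<z z<q → gap z x<z (<-trans z<q q<y)) (≮⇒≥ q≰x))))
landing-above {q} {L} distinct h short (landing x x<y x∈ gap flight) | tri> _ _ y<q =
  landing x x<y x∈ (noneBetween-∷ q L (inj₂ (<⇒≤ y<q)) gap)
    (trans (countBelow-≮ L (<⇒≱ (<-trans x<y y<q) ∘ ≤-pred)) flight)

1≤pred : ∀ {s b} → suc s < b → 1 ≤ pred b
1≤pred s+1<b = ≤-trans (s≤s z≤n) (suc[m]≤n⇒m≤pred[n] s+1<b)

lehmer-landing : ∀ P i b → Distinct P → 1 ≤ b → 1 ≤ size (lehmer P) (suc i) →
  slideIndex (decr (lehmer P) (suc i)) b ≡ just (suc i) → Landing P i b
lehmer-landing (q ∷ L) zero b _ 1≤b h e with slideIndex-step (countBelow q L ∸ 1) (lehmer L) b e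
... | below s+1<b e′ refl = ⊥-elim (n≮n 0 (slideIndex-pos (lehmer L) (pred b) (1≤pred s+1<b) e′))
... | onto b≡ _           = landing-head q L h (trans b≡ (trans (+-comm 1 _) (m∸n+n≡m h)))
... | above _ e′ refl     = ⊥-elim (n≮n 0 (slideIndex-pos (lehmer L) b 1≤b e′))
lehmer-landing (q ∷ L) (suc i) b distinct 1≤b h e with slideIndex-step (countBelow q L) (decr (lehmer L) (suc i)) b e
... | below s+1<b e′ refl = landing-below s+1<b (lehmer-landing L i (pred b) (distinct-tail {q} distinct) (1≤pred s+1<b) h e′)
... | above b<s e′ refl   = landing-above distinct h b<s (lehmer-landing L i b (distinct-tail {q} distinct) 1≤b h e′)

-- Inversions and inverse permutations

countBelow-∷ : ∀ t x L → countBelow t (x ∷ L) ≡ countBelow t (x ∷ []) + countBelow t L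
countBelow-∷ t x L with x <? t
... | yes x<t = trans (countBelow-< L x<t) (cong (_+ countBelow t L) (sym (countBelow-< [] x<t)))
... | no x≮t  = trans (countBelow-≮ L x≮t) (cong (_+ countBelow t L) (sym (countBelow-≮ [] x≮t)))

countBelow-swap : ∀ t y z L → countBelow t (y ∷ z ∷ L) ≡ countBelow t (z ∷ y ∷ L)
countBelow-swap t y z L = begin
  countBelow t (y ∷ z ∷ L)                                        ≡⟨ countBelow-∷ t y (z ∷ L) ⟩
  countBelow t (y ∷ []) + countBelow t (z ∷ L)                    ≡⟨ cong (countBelow t (y ∷ []) +_) (countBelow-∷ t z L) ⟩
  countBelow t (y ∷ []) + (countBelow t (z ∷ []) + countBelow t L) ≡⟨ x∙yz≈y∙xz (countBelow t (y ∷ [])) (countBelow t (z ∷ [])) _ ⟩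
  countBelow t (z ∷ []) + (countBelow t (y ∷ []) + countBelow t L) ≡⟨ cong (countBelow t (z ∷ []) +_) (countBelow-∷ t y L) ⟨
  countBelow t (z ∷ []) + countBelow t (y ∷ L)                    ≡⟨ countBelow-∷ t z (y ∷ L) ⟨
  countBelow t (z ∷ y ∷ L)                                        ∎
  where open ≡-Reasoning

countBelow-∷-cong : ∀ t x {L L′} → countBelow t L ≡ countBelow t L′ → countBelow t (x ∷ L) ≡ countBelow t (x ∷ L′)
countBelow-∷-cong t x {L} {L′} e =
  trans (countBelow-∷ t x L) (trans (cong (countBelow t (x ∷ []) +_) e) (sym (countBelow-∷ t x L′)))

countBelow-swapAt : ∀ t L a → countBelow t (swapAt L a) ≡ countBelow t L
countBelow-swapAt t (y ∷ z ∷ L) (suc zero)    = countBelow-swap t z y L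
countBelow-swapAt t (y ∷ z ∷ L) (suc (suc a)) = countBelow-∷-cong t y (countBelow-swapAt t (z ∷ L) (suc a))
countBelow-swapAt t []          _             = refl
countBelow-swapAt t (y ∷ [])    zero          = refl
countBelow-swapAt t (y ∷ [])    (suc zero)    = refl
countBelow-swapAt t (y ∷ [])    (suc (suc a)) = refl
countBelow-swapAt t (y ∷ z ∷ L) zero          = refl

inv-swapAt-ascent : ∀ ω a → 1 ≤ a → suc a ≤ length ω → ent ω a < ent ω (suc a) → inv (swapAt ω a) ≡ suc (inv ω)
inv-swapAt-ascent (x ∷ y ∷ L) (suc zero) _ _ x<y = begin
  countBelow y (x ∷ L) + (countBelow x L + inv L)        ≡⟨ cong (_+ (countBelow x L + inv L)) (countBelow-< L x<y) ⟩
  suc (countBelow y L + (countBelow x L + inv L))        ≡⟨ cong suc (x∙yz≈y∙xz (countBelow y L) (countBelow x L) _) ⟩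
  suc (countBelow x L + (countBelow y L + inv L))        ≡⟨ cong (λ m → suc (m + (countBelow y L + inv L))) (countBelow-≮ L (<⇒≯ x<y)) ⟨
  suc (countBelow x (y ∷ L) + (countBelow y L + inv L))  ∎
  where open ≡-Reasoning
inv-swapAt-ascent (x ∷ y ∷ L) (suc (suc a)) _ (s≤s a+2≤n) lt = begin
  countBelow x (swapAt (y ∷ L) (suc a)) + inv (swapAt (y ∷ L) (suc a))
    ≡⟨ cong₂ _+_ (countBelow-swapAt x (y ∷ L) (suc a)) (inv-swapAt-ascent (y ∷ L) (suc a) (s≤s z≤n) a+2≤n lt) ⟩
  countBelow x (y ∷ L) + suc (inv (y ∷ L))
    ≡⟨ +-suc _ _ ⟩
  suc (inv (x ∷ y ∷ L)) ∎
  where open ≡-Reasoning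

length-swapAt : ∀ L a → length (swapAt L a) ≡ length L
length-swapAt (x ∷ y ∷ L) (suc zero)    = refl
length-swapAt (x ∷ y ∷ L) (suc (suc a)) = cong suc (length-swapAt (y ∷ L) (suc a))
length-swapAt []          _             = refl
length-swapAt (x ∷ [])    zero          = refl
length-swapAt (x ∷ [])    (suc zero)    = refl
length-swapAt (x ∷ [])    (suc (suc a)) = refl
length-swapAt (x ∷ y ∷ L) zero          = refl

swapVal-suc : ∀ a x → swapVal (suc a) (suc x) ≡ suc (swapVal a x)
swapVal-suc a x with x ≟ a
... | yes refl = swapVal-left (suc x)
... | no x≢a with x ≟ suc a
...   | yes refl  = swapVal-right (suc a)
...   | no x≢a+1  = swapVal-fixed (x≢a ∘ suc-injective) (x≢a+1 ∘ suc-injective)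

swapVal-pos : ∀ a x → 1 ≤ a → 1 ≤ x → 1 ≤ swapVal a x
swapVal-pos a x 1≤a 1≤x with x ≟ a
... | yes _ = s≤s z≤n
... | no _ with x ≟ suc a
...   | yes _ = 1≤a
...   | no _  = 1≤x

ent-swapAt : ∀ L a k → 1 ≤ a → suc a ≤ length L → ent (swapAt L a) k ≡ ent L (swapVal a k)
ent-swapAt (x ∷ y ∷ L) (suc zero)    zero                _ _ = refl
ent-swapAt (x ∷ y ∷ L) (suc zero)    (suc zero)          _ _ = refl
ent-swapAt (x ∷ y ∷ L) (suc zero)    (suc (suc zero))    _ _ = refl
ent-swapAt (x ∷ y ∷ L) (suc zero)    (suc (suc (suc k))) _ _ = refl
ent-swapAt (x ∷ y ∷ L) (suc (suc a)) zero                _ _ = refl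
ent-swapAt (x ∷ y ∷ L) (suc (suc a)) (suc zero)          _ _ = refl
ent-swapAt (x ∷ y ∷ L) (suc (suc a)) (suc (suc k))       _ (s≤s a+2≤n) = begin
  ent (swapAt (y ∷ L) (suc a)) (suc k)            ≡⟨ ent-swapAt (y ∷ L) (suc a) (suc k) (s≤s z≤n) a+2≤n ⟩
  ent (y ∷ L) (swapVal (suc a) (suc k))           ≡⟨ ent-∷ (swapVal-pos (suc a) (suc k) (s≤s z≤n) (s≤s z≤n)) ⟨
  ent (x ∷ y ∷ L) (suc (swapVal (suc a) (suc k))) ≡⟨ cong (ent (x ∷ y ∷ L)) (swapVal-suc (suc a) (suc k)) ⟨
  ent (x ∷ y ∷ L) (swapVal (suc (suc a)) (suc (suc k))) ∎
  where
  open ≡-Reasoning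
  ent-∷ : ∀ {m} → 1 ≤ m → ent (x ∷ y ∷ L) (suc m) ≡ ent (y ∷ L) m
  ent-∷ {suc m} _ = refl
ent-swapAt (x ∷ []) (suc zero)    _ _ (s≤s ())
ent-swapAt (x ∷ []) (suc (suc a)) _ _ (s≤s ())

swapAt-∷ : ∀ x L a → swapAt (x ∷ L) (suc (suc a)) ≡ x ∷ swapAt L (suc a)
swapAt-∷ x []      a = refl
swapAt-∷ x (y ∷ L) a = refl

swapAt-involutive : ∀ L a → swapAt (swapAt L a) a ≡ L
swapAt-involutive (x ∷ y ∷ L)     (suc zero)    = refl
swapAt-involutive (x ∷ y ∷ L)     (suc (suc a)) =
  trans (swapAt-∷ x (swapAt (y ∷ L) (suc a)) a) (cong (x ∷_) (swapAt-involutive (y ∷ L) (suc a)))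
swapAt-involutive []              _             = refl
swapAt-involutive (x ∷ [])        zero          = refl
swapAt-involutive (x ∷ [])        (suc zero)    = refl
swapAt-involutive (x ∷ [])        (suc (suc a)) = refl
swapAt-involutive (x ∷ y ∷ L)     zero          = refl

ent-swapAt-left : ∀ L a → 1 ≤ a → suc a ≤ length L → ent (swapAt L a) a ≡ ent L (suc a)
ent-swapAt-left L a 1≤a a+1≤n = trans (ent-swapAt L a a 1≤a a+1≤n) (cong (ent L) (swapVal-left a))

ent-swapAt-right : ∀ L a → 1 ≤ a → suc a ≤ length L → ent (swapAt L a) (suc a) ≡ ent L a
ent-swapAt-right L a 1≤a a+1≤n = trans (ent-swapAt L a (suc a) 1≤a a+1≤n) (cong (ent L) (swapVal-right a))

swapAt-descent : ∀ ω a → 1 ≤ a → suc a ≤ length ω → ent ω (suc a) < ent ω a → ent (swapAt ω a) a < ent (swapAt ω a) (suc a)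
swapAt-descent ω a 1≤a a+1≤n = subst₂ _<_ (sym (ent-swapAt-left ω a 1≤a a+1≤n)) (sym (ent-swapAt-right ω a 1≤a a+1≤n))

inv-swapAt-descent : ∀ ω a → 1 ≤ a → suc a ≤ length ω → ent ω (suc a) < ent ω a → suc (inv (swapAt ω a)) ≡ inv ω
inv-swapAt-descent ω a 1≤a a+1≤n descent = begin
  suc (inv (swapAt ω a))        ≡⟨ inv-swapAt-ascent (swapAt ω a) a 1≤a (subst (suc a ≤_) (sym (length-swapAt ω a)) a+1≤n)
                                                     (swapAt-descent ω a 1≤a a+1≤n descent) ⟨
  inv (swapAt (swapAt ω a) a)   ≡⟨ cong inv (swapAt-involutive ω a) ⟩
  inv ω                         ∎
  where open ≡-Reasoning

record Inverse (n : ℕ) (ω π : List ℕ) : Set where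
  field
    length-ω : length ω ≡ n
    length-π : length π ≡ n
    π∘ω≡id   : ∀ k → 1 ≤ k → k ≤ n → 1 ≤ ent ω k × ent ω k ≤ n × ent π (ent ω k) ≡ k
    ω∘π≡id   : ∀ v → 1 ≤ v → v ≤ n → 1 ≤ ent π v × ent π v ≤ n × ent ω (ent π v) ≡ v

record Arrangement (n : ℕ) (π : List ℕ) : Set where
  field
    once   : ∀ v → 1 ≤ v → v ≤ n → occurrences v π ≡ 1
    absent : ∀ v → v ≡ 0 ⊎ n < v → occurrences v π ≡ 0

≤-length-ω : ∀ {n ω π m} → Inverse n ω π → m ≤ n → m ≤ length ω
≤-length-ω inverse = subst (_ ≤_) (sym (Inverse.length-ω inverse))

swapVal-range : ∀ {n a x} → 1 ≤ a → suc a ≤ n → 1 ≤ x → x ≤ n → 1 ≤ swapVal a x × swapVal a x ≤ n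
swapVal-range {n} {a} {x} 1≤a a+1≤n 1≤x x≤n with x ≟ a
... | yes _ = s≤s z≤n , a+1≤n
... | no _ with x ≟ suc a
...   | yes _ = 1≤a , ≤-trans (n≤1+n a) a+1≤n
...   | no _  = 1≤x , x≤n

swapVal-outside : ∀ {n a v} → 1 ≤ a → suc a ≤ n → v ≡ 0 ⊎ n < v → swapVal a v ≡ v
swapVal-outside 1≤a a+1≤n (inj₁ refl) = swapVal-fixed (λ 0≡a → <⇒≢ 1≤a 0≡a) (λ ())
swapVal-outside 1≤a a+1≤n (inj₂ n<v)  = swapVal-fixed (λ { refl → <⇒≱ n<v (≤-trans (n≤1+n _) a+1≤n) })
                                                      (λ { refl → <⇒≱ n<v a+1≤n })

ent-map : ∀ (f : ℕ → ℕ) → f 0 ≡ 0 → ∀ P v → ent (map f P) v ≡ f (ent P v)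
ent-map f f0≡0 []      v             = sym f0≡0
ent-map f f0≡0 (x ∷ P) zero          = sym f0≡0
ent-map f f0≡0 (x ∷ P) (suc zero)    = refl
ent-map f f0≡0 (x ∷ P) (suc (suc v)) = ent-map f f0≡0 P (suc v)

inverse-swap : ∀ {n ω π a} → Inverse n ω π → 1 ≤ a → suc a ≤ n → Inverse n (swapAt ω a) (map (swapVal a) π)
inverse-swap {n} {ω} {π} {a} inverse 1≤a a+1≤n = record
  { length-ω = trans (length-swapAt ω a) length-ω
  ; length-π = trans (length-map (swapVal a) π) length-π
  ; π∘ω≡id   = π′∘ω′≡id
  ; ω∘π≡id   = ω′∘π′≡id
  }
  where
  open Inverse inverse
  open ≡-Reasoning
  swapVal-0 : swapVal a 0 ≡ 0
  swapVal-0 = swapVal-outside 1≤a a+1≤n (inj₁ refl)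
  ω′k≡ : ∀ k → ent (swapAt ω a) k ≡ ent ω (swapVal a k)
  ω′k≡ k = ent-swapAt ω a k 1≤a (≤-length-ω inverse a+1≤n)
  π′v≡ : ∀ v → ent (map (swapVal a) π) v ≡ swapVal a (ent π v)
  π′v≡ = ent-map (swapVal a) swapVal-0 π
  π′∘ω′≡id : ∀ k → 1 ≤ k → k ≤ n →
    1 ≤ ent (swapAt ω a) k × ent (swapAt ω a) k ≤ n × ent (map (swapVal a) π) (ent (swapAt ω a) k) ≡ k
  π′∘ω′≡id k 1≤k k≤n with swapVal-range 1≤a a+1≤n 1≤k k≤n
  ... | 1≤k′ , k′≤n with π∘ω≡id (swapVal a k) 1≤k′ k′≤n
  ...   | 1≤v , v≤n , πv≡k′ = subst (1 ≤_) (sym (ω′k≡ k)) 1≤v , subst (_≤ n) (sym (ω′k≡ k)) v≤n , (begin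
    ent (map (swapVal a) π) (ent (swapAt ω a) k) ≡⟨ π′v≡ _ ⟩
    swapVal a (ent π (ent (swapAt ω a) k))       ≡⟨ cong (λ v → swapVal a (ent π v)) (ω′k≡ k) ⟩
    swapVal a (ent π (ent ω (swapVal a k)))      ≡⟨ cong (swapVal a) πv≡k′ ⟩
    swapVal a (swapVal a k)                      ≡⟨ swapVal-involutive a k ⟩
    k                                            ∎)
  ω′∘π′≡id : ∀ v → 1 ≤ v → v ≤ n →
    1 ≤ ent (map (swapVal a) π) v × ent (map (swapVal a) π) v ≤ n × ent (swapAt ω a) (ent (map (swapVal a) π) v) ≡ v
  ω′∘π′≡id v 1≤v v≤n with ω∘π≡id v 1≤v v≤n
  ... | 1≤k , k≤n , ωk≡v with swapVal-range 1≤a a+1≤n 1≤k k≤n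
  ...   | 1≤k′ , k′≤n = subst (1 ≤_) (sym (π′v≡ v)) 1≤k′ , subst (_≤ n) (sym (π′v≡ v)) k′≤n , (begin
    ent (swapAt ω a) (ent (map (swapVal a) π) v) ≡⟨ cong (ent (swapAt ω a)) (π′v≡ v) ⟩
    ent (swapAt ω a) (swapVal a (ent π v))       ≡⟨ ω′k≡ _ ⟩
    ent ω (swapVal a (swapVal a (ent π v)))      ≡⟨ cong (ent ω) (swapVal-involutive a (ent π v)) ⟩
    ent ω (ent π v)                              ≡⟨ ωk≡v ⟩
    v                                            ∎)

arrangement-swap : ∀ {n π a} → Arrangement n π → 1 ≤ a → suc a ≤ n → Arrangement n (map (swapVal a) π)
arrangement-swap {n} {π} {a} arr 1≤a a+1≤n = record
  { once   = λ v 1≤v v≤n → let (1≤v′ , v′≤n) = swapVal-range 1≤a a+1≤n 1≤v v≤n in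
      trans (occurrences-swapVal a v π) (once (swapVal a v) 1≤v′ v′≤n)
  ; absent = λ v out →
      trans (occurrences-swapVal a v π) (trans (cong (λ v′ → occurrences v′ π) (swapVal-outside 1≤a a+1≤n out)) (absent v out))
  }
  where open Arrangement arr

arrangement-distinct : ∀ {n π} → Arrangement n π → Distinct π
arrangement-distinct {n} arr v with v ≟ 0 | n <? v
... | yes v≡0 | _       = ≤-trans (≤-reflexive (Arrangement.absent arr v (inj₁ v≡0))) z≤n
... | no _    | yes n<v = ≤-trans (≤-reflexive (Arrangement.absent arr v (inj₂ n<v))) z≤n
... | no v≢0  | no n≮v  = ≤-reflexive (Arrangement.once arr v (n≢0⇒n>0 v≢0) (≮⇒≥ n≮v))

countBelow-arrangement : ∀ {n π} → Arrangement n π → ∀ a → a ≤ n → countBelow (suc a) π ≡ a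
countBelow-arrangement {π = π} arr zero _ =
  trans (countBelow-suc 0 π) (cong₂ _+_ (countBelow-zero π) (Arrangement.absent arr 0 (inj₁ refl)))
countBelow-arrangement {π = π} arr (suc a) a+1≤n = begin
  countBelow (suc (suc a)) π                        ≡⟨ countBelow-suc (suc a) π ⟩
  countBelow (suc a) π + occurrences (suc a) π      ≡⟨ cong₂ _+_ (countBelow-arrangement arr a (≤-trans (n≤1+n a) a+1≤n))
                                                                 (Arrangement.once arr (suc a) (s≤s z≤n) a+1≤n) ⟩
  a + 1                                             ≡⟨ +-comm a 1 ⟩
  suc a                                             ∎
  where open ≡-Reasoning

iota : ℕ → ℕ → List ℕ
iota m zero    = []
iota m (suc n) = m ∷ iota (suc m) n

applyUpTo-iota : ∀ f m n → (∀ i → f i ≡ m + i) → applyUpTo f n ≡ iota m n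
applyUpTo-iota f m zero    _ = refl
applyUpTo-iota f m (suc n) h = cong₂ _∷_ (trans (h 0) (+-identityʳ m))
  (applyUpTo-iota (f ∘ suc) (suc m) n (λ i → trans (h (suc i)) (+-suc m i)))

upTo-iota : ∀ n → map suc (upTo n) ≡ iota 1 n
upTo-iota n = trans (map-applyUpTo id suc n) (applyUpTo-iota suc 1 n (λ _ → refl))

length-iota : ∀ m n → length (iota m n) ≡ n
length-iota m zero    = refl
length-iota m (suc n) = cong suc (length-iota (suc m) n)

ent-iota : ∀ m n k → k < n → ent (iota m n) (suc k) ≡ m + k
ent-iota m (suc n) zero    _         = sym (+-identityʳ m)
ent-iota m (suc n) (suc k) (s≤s k<n) = trans (ent-iota (suc m) n k k<n) (sym (+-suc m k))

ent-iota-1 : ∀ n k → 1 ≤ k → k ≤ n → ent (iota 1 n) k ≡ k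
ent-iota-1 n (suc k) _ k<n = ent-iota 1 n k k<n

occurrences-iota-outside : ∀ m n v → v < m ⊎ m + n ≤ v → occurrences v (iota m n) ≡ 0
occurrences-iota-outside m zero    v _   = refl
occurrences-iota-outside m (suc n) v (inj₁ v<m) =
  trans (occurrences-≢ {x = m} (iota (suc m) n) (λ { refl → n≮n m v<m }))
        (occurrences-iota-outside (suc m) n v (inj₁ (m<n⇒m<1+n v<m)))
occurrences-iota-outside m (suc n) v (inj₂ m+n+1≤v) =
  trans (occurrences-≢ {x = m} (iota (suc m) n) (λ { refl → m+1+n≰m m m+n+1≤v }))
        (occurrences-iota-outside (suc m) n v (inj₂ (≤-trans (≤-reflexive (sym (+-suc m n))) m+n+1≤v)))

occurrences-iota-inside : ∀ m n v → m ≤ v → v < m + n → occurrences v (iota m n) ≡ 1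
occurrences-iota-inside m zero    v m≤v v<m+0 = ⊥-elim (<⇒≱ v<m+0 (≤-trans (≤-reflexive (+-identityʳ m)) m≤v))
occurrences-iota-inside m (suc n) v m≤v v<m+n with m ≟ v
... | yes refl = trans (occurrences-≡ (iota (suc m) n) refl)
                       (cong suc (occurrences-iota-outside (suc m) n m (inj₁ (n<1+n m))))
... | no m≢v   = trans (occurrences-≢ (iota (suc m) n) m≢v)
                       (occurrences-iota-inside (suc m) n v (≤∧≢⇒< m≤v m≢v) (≤-trans v<m+n (≤-reflexive (+-suc m n))))

countBelow-iota : ∀ t m n → t ≤ m → countBelow t (iota m n) ≡ 0
countBelow-iota t m zero    _   = refl
countBelow-iota t m (suc n) t≤m =
  trans (countBelow-≮ (iota (suc m) n) (≤⇒≯ t≤m)) (countBelow-iota t (suc m) n (m≤n⇒m≤1+n t≤m))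

inv-iota : ∀ m n → inv (iota m n) ≡ 0
inv-iota m zero    = refl
inv-iota m (suc n) = cong₂ _+_ (countBelow-iota m (suc m) n (n≤1+n m)) (inv-iota (suc m) n)

lehmer-iota : ∀ m n → lehmer (iota m n) ≈T []
lehmer-iota m zero    i             = refl
lehmer-iota m (suc n) zero          = refl
lehmer-iota m (suc n) (suc zero)    = countBelow-iota m (suc m) n (n≤1+n m)
lehmer-iota m (suc n) (suc (suc i)) = lehmer-iota (suc m) n (suc i)

inverse-iota : ∀ n → Inverse n (iota 1 n) (iota 1 n)
inverse-iota n = record
  { length-ω = length-iota 1 n
  ; length-π = length-iota 1 n
  ; π∘ω≡id   = fixed
  ; ω∘π≡id   = fixed
  }
  where
  fixed : ∀ k → 1 ≤ k → k ≤ n → 1 ≤ ent (iota 1 n) k × ent (iota 1 n) k ≤ n × ent (iota 1 n) (ent (iota 1 n) k) ≡ k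
  fixed k 1≤k k≤n rewrite ent-iota-1 n k 1≤k k≤n = 1≤k , k≤n , ent-iota-1 n k 1≤k k≤n

arrangement-iota : ∀ n → Arrangement n (iota 1 n)
arrangement-iota n = record
  { once   = λ v 1≤v v≤n → occurrences-iota-inside 1 n v 1≤v (s≤s v≤n)
  ; absent = λ { v (inj₁ refl) → occurrences-iota-outside 1 n 0 (inj₁ z<s)
               ; v (inj₂ n<v)  → occurrences-iota-outside 1 n v (inj₂ n<v) }
  }

-- The tower diagram of a permutation

indexBeforeSuc-first : ∀ P a k → 1 ≤ a → ent P (suc k) ≡ a →
  (∀ m → m < k → ent P (suc m) ≢ a × ent P (suc m) ≢ suc a) → indexBeforeSuc a P ≡ just (suc k)
indexBeforeSuc-first []      a k       1≤a Pk+1≡a _       = ⊥-elim (<⇒≢ 1≤a Pk+1≡a)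
indexBeforeSuc-first (q ∷ P) a zero    _   q≡a     _       = indexBeforeSuc-here P q≡a
indexBeforeSuc-first (q ∷ P) a (suc k) 1≤a Pk+1≡a  earlier =
  trans (indexBeforeSuc-there P q≢a q≢a+1)
        (cong (mapᴹ suc) (indexBeforeSuc-first P a k 1≤a Pk+1≡a (λ m m<k → earlier (suc m) (s≤s m<k))))
  where
  q≢a : q ≢ a
  q≢a = proj₁ (earlier 0 (s≤s z≤n))
  q≢a+1 : q ≢ suc a
  q≢a+1 = proj₂ (earlier 0 (s≤s z≤n))

indexBeforeSuc-ascent : ∀ {n ω π a} → Inverse n ω π → 1 ≤ a → suc a ≤ n → ent ω a < ent ω (suc a) →
  indexBeforeSuc a π ≡ just (ent ω a)
indexBeforeSuc-ascent {n} {ω} {π} {a} inverse 1≤a a+1≤n ascent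
  with ent ω a in ωa≡ | Inverse.π∘ω≡id inverse a 1≤a (≤-trans (n≤1+n a) a+1≤n)
... | suc k | _ , k+1≤n , πk+1≡a = indexBeforeSuc-first π a k 1≤a πk+1≡a earlier
  where
  earlier : ∀ m → m < k → ent π (suc m) ≢ a × ent π (suc m) ≢ suc a
  earlier m m<k = (λ πm+1≡a → <⇒≢ (s≤s m<k) (trans (sym ωπm+1) (trans (cong (ent ω) πm+1≡a) ωa≡)))
                , (λ πm+1≡a+1 → <⇒≢ (<-trans (s≤s m<k) ascent) (trans (sym ωπm+1) (cong (ent ω) πm+1≡a+1)))
    where
    ωπm+1 : ent ω (ent π (suc m)) ≡ suc m
    ωπm+1 = proj₂ (proj₂ (Inverse.ω∘π≡id inverse (suc m) (s≤s z≤n) (≤-trans (s≤s (<⇒≤ m<k)) k+1≤n)))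

inverse-adjacent-≢ : ∀ {n ω π a} → Inverse n ω π → 1 ≤ a → suc a ≤ n → ent ω a ≢ ent ω (suc a)
inverse-adjacent-≢ {n} {ω} {π} {a} inverse 1≤a a+1≤n ωa≡ωa+1 = 1+n≢n (begin
  suc a                     ≡⟨ proj₂ (proj₂ (π∘ω≡id (suc a) (s≤s z≤n) a+1≤n)) ⟨
  ent π (ent ω (suc a))     ≡⟨ cong (ent π) ωa≡ωa+1 ⟨
  ent π (ent ω a)           ≡⟨ proj₂ (proj₂ (π∘ω≡id a 1≤a (≤-trans (n≤1+n a) a+1≤n))) ⟩
  a                         ∎)
  where
  open Inverse inverse
  open ≡-Reasoning

inv-swapAt-≤ : ∀ {n ω π a} → Inverse n ω π → 1 ≤ a → suc a ≤ n → inv (swapAt ω a) ≤ suc (inv ω)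
inv-swapAt-≤ {n} {ω} {π} {a} inverse 1≤a a+1≤n with <-cmp (ent ω a) (ent ω (suc a))
... | tri< ascent _ _ = ≤-reflexive (inv-swapAt-ascent ω a 1≤a (≤-length-ω inverse a+1≤n) ascent)
... | tri≈ _ ωa≡ωa+1 _ = ⊥-elim (inverse-adjacent-≢ inverse 1≤a a+1≤n ωa≡ωa+1)
... | tri> _ _ descent =
  ≤-trans (n≤1+n _) (≤-trans (≤-reflexive (inv-swapAt-descent ω a 1≤a (≤-length-ω inverse a+1≤n) descent)) (n≤1+n _))

inv-foldl-swapAt-≤ : ∀ {n ω π} α → Inverse n ω π → LettersIn n α → inv (foldl swapAt ω α) ≤ inv ω + length α
inv-foldl-swapAt-≤ []      _       []                  = ≤-reflexive (sym (+-identityʳ _))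
inv-foldl-swapAt-≤ {ω = ω} (a ∷ α) inverse ((1≤a , a+1≤n) ∷ letters) = begin
  inv (foldl swapAt (swapAt ω a) α)  ≤⟨ inv-foldl-swapAt-≤ α (inverse-swap inverse 1≤a a+1≤n) letters ⟩
  inv (swapAt ω a) + length α        ≤⟨ +-monoˡ-≤ (length α) (inv-swapAt-≤ inverse 1≤a a+1≤n) ⟩
  suc (inv ω) + length α             ≡⟨ +-suc (inv ω) (length α) ⟨
  inv ω + suc (length α)             ∎
  where open ≤-Reasoning

reduced-head-ascent : ∀ {n ω π a} α → Inverse n ω π → LettersIn n (a ∷ α) →
  inv (foldl swapAt ω (a ∷ α)) ≡ inv ω + length (a ∷ α) → ent ω a < ent ω (suc a)
reduced-head-ascent {n} {ω} {π} {a} α inverse ((1≤a , a+1≤n) ∷ letters) reduced with <-cmp (ent ω a) (ent ω (suc a))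
... | tri< ascent _ _  = ascent
... | tri≈ _ ωa≡ωa+1 _ = ⊥-elim (inverse-adjacent-≢ inverse 1≤a a+1≤n ωa≡ωa+1)
... | tri> _ _ descent = ⊥-elim (n≮n _ (begin-strict
  inv ω + length α                   <⟨ n<1+n _ ⟩
  suc (inv ω + length α)             ≡⟨ +-suc (inv ω) (length α) ⟨
  inv ω + suc (length α)             ≡⟨ reduced ⟨
  inv (foldl swapAt (swapAt ω a) α)  ≤⟨ inv-foldl-swapAt-≤ α (inverse-swap inverse 1≤a a+1≤n) letters ⟩
  inv (swapAt ω a) + length α        ≤⟨ +-monoˡ-≤ (length α) (n≤1+n _) ⟩
  suc (inv (swapAt ω a)) + length α  ≡⟨ cong (_+ length α) (inv-swapAt-descent ω a 1≤a (≤-length-ω inverse a+1≤n) descent) ⟩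
  inv ω + length α                   ∎))
  where open ≤-Reasoning

record Invariant (n : ℕ) (ω T : List ℕ) : Set where
  constructor invariant
  field
    ω⁻¹         : List ℕ
    inverse     : Inverse n ω ω⁻¹
    arrangement : Arrangement n ω⁻¹
    diagram     : T ≈T lehmer ω⁻¹

invariant-iota : ∀ n → Invariant n (iota 1 n) []
invariant-iota n = invariant (iota 1 n) (inverse-iota n) (arrangement-iota n) (λ i → sym (lehmer-iota 1 n i))

invariant-ascent : ∀ {n ω T a} → Invariant n ω T → 1 ≤ a → suc a ≤ n → ent ω a < ent ω (suc a) →
  slide a T ≡ just (incr T (ent ω a)) × Invariant n (swapAt ω a) (incr T (ent ω a))
invariant-ascent {n} {ω} {T} {suc d} (invariant π inverse arrangement T≈) 1≤a a+1≤n ascent =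
  slid , invariant (map (swapVal (suc d)) π) (inverse-swap inverse 1≤a a+1≤n) (arrangement-swap arrangement 1≤a a+1≤n)
                   (λ i → trans (incr-cong T (lehmer π) (ent ω (suc d)) 1≤ωa T≈ i) (cong (λ L → size L i) (sym code)))
  where
  a∈π : occurrences (suc d) π ≡ 1
  a∈π = Arrangement.once arrangement (suc d) 1≤a (≤-trans (n≤1+n _) a+1≤n)
  a+1∈π : occurrences (suc (suc d)) π ≡ 1
  a+1∈π = Arrangement.once arrangement (suc (suc d)) (s≤s z≤n) a+1≤n
  1≤ωa : 1 ≤ ent ω (suc d)
  1≤ωa = proj₁ (Inverse.π∘ω≡id inverse (suc d) 1≤a (≤-trans (n≤1+n _) a+1≤n))
  code : lehmer (map (swapVal (suc d)) π) ≡ incr (lehmer π) (ent ω (suc d))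
  code = lehmer-swapVal (suc d) π a∈π a+1∈π (indexBeforeSuc-ascent inverse 1≤a a+1≤n ascent)
  slid : slide (suc d) T ≡ just (incr T (ent ω (suc d)))
  slid = begin
    slide (suc d) T                                            ≡⟨ slide-slideIndex d T ⟩
    mapᴹ (incr T) (slideIndex T (suc d))                       ≡⟨ cong (mapᴹ (incr T)) (slideIndex-cong T (lehmer π) (suc d) T≈ 1≤a) ⟩
    mapᴹ (incr T) (slideIndex (lehmer π) (suc d))              ≡⟨ cong (mapᴹ (incr T) ∘ slideIndex (lehmer π))
                                                                       (countBelow-arrangement arrangement (suc d) (≤-trans (n≤1+n _) a+1≤n)) ⟨
    mapᴹ (incr T) (slideIndex (lehmer π) (countBelow (suc (suc d)) π)) ≡⟨ cong (mapᴹ (incr T)) (slideIndex-lehmer π (suc d) a∈π a+1∈π) ⟩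
    mapᴹ (incr T) (indexBeforeSuc (suc d) π)                   ≡⟨ cong (mapᴹ (incr T)) (indexBeforeSuc-ascent inverse 1≤a a+1≤n ascent) ⟩
    just (incr T (ent ω (suc d)))                              ∎
    where open ≡-Reasoning

slideWordFrom-∷ : ∀ {a T T′} α → slide a T ≡ just T′ → slideWordFrom T (a ∷ α) ≡ slideWordFrom T′ α
slideWordFrom-∷ {a} {T} α slid with slide a T
... | just _ with slid
...   | refl = refl

invariant-reduced : ∀ {n ω T} α → Invariant n ω T → LettersIn n α →
  inv (foldl swapAt ω α) ≡ inv ω + length α →
  Σ (List ℕ) λ T′ → slideWordFrom T α ≡ just T′ × Invariant n (foldl swapAt ω α) T′
invariant-reduced {T = T} [] I [] _ = T , refl , I
invariant-reduced {ω = ω} {T} (a ∷ α) I letters@((1≤a , a+1≤n) ∷ letters′) reduced =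
  let (slid , I′)       = invariant-ascent I 1≤a a+1≤n ascent
      (T′ , slid′ , I″) = invariant-reduced α I′ letters′ reduced′
  in T′ , trans (slideWordFrom-∷ {a} {T} α slid) slid′ , I″
  where
  ascent : ent ω a < ent ω (suc a)
  ascent = reduced-head-ascent α (Invariant.inverse I) letters reduced
  reduced′ : inv (foldl swapAt (swapAt ω a) α) ≡ inv (swapAt ω a) + length α
  reduced′ = trans reduced (trans (+-suc _ _) (cong (_+ length α)
               (sym (inv-swapAt-ascent ω a 1≤a (≤-length-ω (Invariant.inverse I) a+1≤n) ascent))))

occurs-drop⇒position : ∀ x i L → 1 ≤ occurrences x (drop i L) → Σ ℕ λ k → i < k × k ≤ length L × ent L k ≡ x
occurs-drop⇒position x zero (q ∷ L) x∈ with q ≟ x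
... | yes q≡x = 1 , s≤s z≤n , s≤s z≤n , q≡x
... | no q≢x with occurs-drop⇒position x zero L (≤-trans x∈ (≤-reflexive (occurrences-≢ L q≢x)))
...   | suc k , _ , k≤l , Lk≡x = suc (suc k) , s≤s z≤n , s≤s k≤l , Lk≡x
occurs-drop⇒position x (suc i) (q ∷ L) x∈ with occurs-drop⇒position x i L x∈
... | suc k , i<k , k≤l , Lk≡x = suc (suc k) , s≤s i<k , s≤s k≤l , Lk≡x

ent-pos⇒≤length : ∀ L k → 1 ≤ ent L k → k ≤ length L
ent-pos⇒≤length (x ∷ L) (suc zero)    _ = s≤s z≤n
ent-pos⇒≤length (x ∷ L) (suc (suc k)) h = s≤s (ent-pos⇒≤length L (suc k) h)

-- For a permutation the landing value is x = ω⁻¹_{i+1} - 1, which comes later in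
-- ω⁻¹: so ω_{x+1} = i + 1 < ω_x, i.e. x is a descent with border cell in column i + 1.
border-from-landing : ∀ {n ω π i b} → Inverse n ω π → Arrangement n π → Landing π i b →
  ∃! _≡_ (λ r → Border ω r (suc i))
border-from-landing {n} {ω} {π} {i} inverse arrangement (landing x x<y later gap _)
  with occurs-drop⇒position x (suc i) π later
... | k , i+1<k , k≤l , πk≡x = x , border , unique
  where
  open Inverse inverse
  y : ℕ
  y = ent π (suc i)
  i+1≤n : suc i ≤ n
  i+1≤n = subst (suc i ≤_) length-π (ent-pos⇒≤length π (suc i) (≤-trans (s≤s z≤n) x<y))
  y-props : 1 ≤ y × y ≤ n × ent ω y ≡ suc i
  y-props = ω∘π≡id (suc i) (s≤s z≤n) i+1≤n
  k-props : 1 ≤ ent π k × ent π k ≤ n × ent ω (ent π k) ≡ k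
  k-props = ω∘π≡id k (≤-trans (s≤s z≤n) i+1<k) (subst (k ≤_) length-π k≤l)
  1≤x : 1 ≤ x
  1≤x = subst (1 ≤_) πk≡x (proj₁ k-props)
  ωx≡k : ent ω x ≡ k
  ωx≡k = trans (cong (ent ω) (sym πk≡x)) (proj₂ (proj₂ k-props))
  y≡x+1 : y ≡ suc x
  y≡x+1 with suc x <? y
  ... | no x+1≮y  = ≤-antisym (≮⇒≥ x+1≮y) x<y
  ... | yes x+1<y = ⊥-elim (1+n≢0 (trans (sym (Arrangement.once arrangement (suc x) (s≤s z≤n)
                      (≤-trans (<⇒≤ x+1<y) (proj₁ (proj₂ y-props))))) (gap (suc x) (n<1+n x) x+1<y)))
  ωx+1≡i+1 : ent ω (suc x) ≡ suc i
  ωx+1≡i+1 = trans (cong (ent ω) (sym y≡x+1)) (proj₂ (proj₂ y-props))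
  border : Border ω x (suc i)
  border = (suc x , 1≤x , n<1+n x , ≤-length-ω inverse (subst (_≤ n) y≡x+1 (proj₁ (proj₂ y-props))) ,
            subst₂ _<_ (sym ωx+1≡i+1) (sym ωx≡k) i+1<k , sym ωx+1≡i+1) , sym ωx+1≡i+1
  unique : ∀ {r} → Border ω r (suc i) → x ≡ r
  unique {r} ((j , _ , r<j , j≤l , _ , _) , i+1≡ωr+1) = suc-injective (begin
    suc x                  ≡⟨ y≡x+1 ⟨
    ent π (suc i)          ≡⟨ cong (ent π) i+1≡ωr+1 ⟩
    ent π (ent ω (suc r))  ≡⟨ proj₂ (proj₂ (π∘ω≡id (suc r) (s≤s z≤n) (≤-trans r<j (subst (j ≤_) length-ω j≤l)))) ⟩
    suc r                  ∎)
    where open ≡-Reasoning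

corner-flight : ∀ T i j → Corner T i j → Σ ℕ λ b → 1 ≤ b × slideIndex (decr T i) b ≡ just i
corner-flight T i j (_ , top , suc d , _ , T′ , slid , T′≈T)
  with slideIndex (decr T i) (suc d) in lands | slide-slideIndex d (decr T i)
... | nothing | slid≡ with () ← trans (sym slid) slid≡
... | just u  | slid≡ with u ≟ i
...   | yes refl = suc d , s≤s z≤n , lands
...   | no u≢i   = ⊥-elim (1+n≢n (begin
  suc j                              ≡⟨ top ⟩
  size T i                           ≡⟨ T′≈T i ⟨
  size T′ i                          ≡⟨ cong (λ L → size L i) (just-injective (trans (sym slid) slid≡)) ⟩
  size (incr (decr T i) u) i         ≡⟨ size-incr-other (decr T i) u i (u≢i ∘ sym) ⟩
  size (decr T i) i                  ≡⟨ size-decr-same T i ⟩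
  size T i ∸ 1                       ≡⟨ cong (_∸ 1) top ⟨
  j                                  ∎))
  where open ≡-Reasoning

corner⇒border : ∀ {n ω T} → Invariant n ω T → ∀ i j → Corner T i j → ∃! _≡_ (λ r → Border ω r i)
corner⇒border _ zero _ ((() , _) , _)
corner⇒border {T = T} (invariant π inverse arrangement T≈) (suc i) j corner@((_ , j<Tᵢ) , _)
  with corner-flight T (suc i) j corner
... | b , 1≤b , lands = border-from-landing inverse arrangement
        (lehmer-landing π i b (arrangement-distinct arrangement) 1≤b 1≤codeᵢ lands′)
  where
  1≤codeᵢ : 1 ≤ size (lehmer π) (suc i)
  1≤codeᵢ = ≤-trans (s≤s z≤n) (≤-trans j<Tᵢ (≤-reflexive (T≈ (suc i))))
  lands′ : slideIndex (decr (lehmer π) (suc i)) b ≡ just (suc i)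
  lands′ = trans (slideIndex-cong (decr (lehmer π) (suc i)) (decr T (suc i)) b
                   (λ m → sym (decr-cong T (lehmer π) (suc i) T≈ m)) 1≤b) lands

invariant-descent : ∀ {n ω T a} → Invariant n ω T → 1 ≤ a → suc a ≤ n → ent ω (suc a) < ent ω a →
  1 ≤ size T (ent ω (suc a)) × Invariant n (swapAt ω a) (decr T (ent ω (suc a)))
invariant-descent {n} {ω} {T} {a} (invariant π inverse arrangement T≈) 1≤a a+1≤n descent =
  1≤Tc , invariant π′ inverse′ arrangement′ diagram
  where
  π′ : List ℕ
  π′ = map (swapVal a) π
  inverse′ : Inverse n (swapAt ω a) π′
  inverse′ = inverse-swap inverse 1≤a a+1≤n
  arrangement′ : Arrangement n π′
  arrangement′ = arrangement-swap arrangement 1≤a a+1≤n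
  a+1≤length : suc a ≤ length ω
  a+1≤length = ≤-length-ω inverse a+1≤n
  c : ℕ
  c = ent ω (suc a)
  1≤c : 1 ≤ c
  1≤c = proj₁ (Inverse.π∘ω≡id inverse (suc a) (s≤s z≤n) a+1≤n)
  code : lehmer π ≡ incr (lehmer π′) c
  code = begin
    lehmer π                                ≡⟨ cong lehmer (map-swapVal-involutive a π) ⟨
    lehmer (map (swapVal a) π′)             ≡⟨ lehmer-swapVal a π′ (Arrangement.once arrangement′ a 1≤a (≤-trans (n≤1+n a) a+1≤n))
                                                 (Arrangement.once arrangement′ (suc a) (s≤s z≤n) a+1≤n)
                                                 (indexBeforeSuc-ascent inverse′ 1≤a a+1≤n (swapAt-descent ω a 1≤a a+1≤length descent)) ⟩
    incr (lehmer π′) (ent (swapAt ω a) a)   ≡⟨ cong (incr (lehmer π′)) (ent-swapAt-left ω a 1≤a a+1≤length) ⟩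
    incr (lehmer π′) c                      ∎
    where open ≡-Reasoning
  1≤Tc : 1 ≤ size T c
  1≤Tc = subst (1 ≤_) (sym (trans (T≈ c) (trans (cong (λ L → size L c) code) (size-incr-same (lehmer π′) c 1≤c)))) (s≤s z≤n)
  diagram : decr T c ≈T lehmer π′
  diagram m = trans (decr-cong T (lehmer π) c T≈ m)
                    (trans (cong (λ L → size (decr L c) m) code) (decr-incr (lehmer π′) c 1≤c m))

border⇒corner : ∀ {n ω T} → Invariant n ω T → ∀ r c → Border ω r c → ∃! _≡_ (λ j → Corner T c j)
border⇒corner {n} {ω} {T} I r .(ent ω (suc r)) ((j , 1≤r , r<j , j≤l , ωj<ωr , c≡ωj) , refl) =
  pred (size T c) , corner , λ (_ , top , _) → cong pred (sym top)
  where
  c : ℕ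
  c = ent ω (suc r)
  r+1≤n : suc r ≤ n
  r+1≤n = ≤-trans r<j (subst (j ≤_) (Inverse.length-ω (Invariant.inverse I)) j≤l)
  r+1≤length : suc r ≤ length ω
  r+1≤length = ≤-length-ω (Invariant.inverse I) r+1≤n
  descent : c < ent ω r
  descent = subst (_< ent ω r) (sym c≡ωj) ωj<ωr
  removed : 1 ≤ size T c × Invariant n (swapAt ω r) (decr T c)
  removed = invariant-descent I 1≤r r+1≤n descent
  1≤Tc : 1 ≤ size T c
  1≤Tc = proj₁ removed
  slid : slide r (decr T c) ≡ just (incr (decr T c) c)
  slid = trans (proj₁ (invariant-ascent (proj₂ removed) 1≤r r+1≤n (swapAt-descent ω r 1≤r r+1≤length descent)))
               (cong (λ k → just (incr (decr T c) k)) (ent-swapAt-left ω r 1≤r r+1≤length))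
  1≤c : 1 ≤ c
  1≤c = proj₁ (Inverse.π∘ω≡id (Invariant.inverse I) (suc r) (s≤s z≤n) r+1≤n)
  corner : Corner T c (pred (size T c))
  corner = (1≤c , ≤-reflexive (suc-pred (size T c) ⦃ >-nonZero 1≤Tc ⦄)) , suc-pred (size T c) ⦃ >-nonZero 1≤Tc ⦄ ,
           r , 1≤r , incr (decr T c) c , slid , incr-decr T c 1≤c 1≤Tc

mainTheorem4 : (ω : List ℕ) → IsPerm ω →
    (w : List ℕ) → ReducedWord ω w →
    (T : List ℕ) → slideWord w ≡ just T →
    ((i j : ℕ) → Corner T i j → ∃! _≡_ (λ r → Border ω r i))
    × ((r c : ℕ) → Border ω r c → ∃! _≡_ (λ j → Corner T c j))
mainTheorem4 ω _ w (letters , w↦ω , length≡inv) T slid = corner⇒border tracked , border⇒corner tracked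
  where
  n : ℕ
  n = length ω
  w↦ω′ : foldl swapAt (iota 1 n) w ≡ ω
  w↦ω′ = trans (cong (λ ι → foldl swapAt ι w) (sym (upTo-iota n))) w↦ω
  reduced : inv (foldl swapAt (iota 1 n) w) ≡ inv (iota 1 n) + length w
  reduced = trans (cong inv w↦ω′) (trans (sym length≡inv) (cong (_+ length w) (sym (inv-iota 1 n))))
  tracked : Invariant n ω T
  tracked with invariant-reduced w (invariant-iota n) letters reduced
  ... | T′ , slid′ , I with trans (sym slid) slid′
  ...   | refl = subst (λ ω′ → Invariant n ω′ T) w↦ω′ I
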